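{- Let $\delta,d$ be positive integers with $d>2$, let $c\in[\frac{1}{2},1)$ and $m\in[0,1]$ with $(1-c)+m(\delta+\delta^2)<\frac{1}{2}$. Let $G$ be a connected graph with maximum degree $\delta$, let $w: V(G)\to[0,1]$ be a weight function with $w(G)=1$ and $w^{\max}\leq m$, and suppose $G$ does not have a $(w,c,d)$-balanced separator. Let $X$ be a laminar collection of star separations of $G$. Then (every member of $X$ is $(1-c)$-skewed and, for a tree decomposition corresponding to $X$,) the central bag $\beta$ for $X$ exists, $\beta$ is perpendicular to $X$, $w_X(\beta)=1$, and $G[\beta]$ does not have a $(w_X,c,d-2)$-balanced separator.
   Context: $w(Y)=\sum_{u\in Y}w(u)$, $w^{\max}=\max_u w(u)$. $N^d_H[v]$ is the set of vertices at distance at most $d$ from $v$ in a graph $H$. A set $S\subseteq V(H)$ is $d$-bounded (in $H$) if $S\subseteq N^d_H[v_1]\cup\dots\cup N^d_H[v_{d'}]$ for some $v_1,\dots,v_{d'}$, $d'\leq d$. For a weight function $\omega$ on $V(H)$, a $(\omega,c,d)$-balanced separator of $H$ is a $d$-bounded set $Y$ with $\omega(Z)\leq c$ for every component $Z$ of $H\setminus Y$. A separation of $G$ is a triple $(A,C,B)$ of pairwise disjoint sets with union $V(G)$ and no edges between $A$ and $B$. A clique star is a set $Y$ with a nonempty clique $K$ such that $K\subseteq Y\subseteq N[K]$ ($K$ a center); a star separation is a separation $(A,C,B)$ with $C$ a clique star. A separation is $\varepsilon$-skewed if $w(A)<\varepsilon$ or $w(B)<\varepsilon$, and is then written with $w(A)<\varepsilon$.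 With $X_i=A_i\cup C_i$, $Y_i=C_i\cup B_i$, two separations are non-crossing if for some $i\in\{1,2\}$ either ($X_i\subseteq X_{3-i}$ and $Y_{3-i}\subseteq Y_i$) or ($X_i\subseteq Y_{3-i}$ and $X_{3-i}\subseteq Y_i$); a collection is laminar if pairwise non-crossing. For a tree decomposition $(T,\chi)$ and an edge $e=t_1t_2$ with $T_j$ the component of $T\setminus e$ containing $t_j$, $C_e=\chi(t_1)\cap\chi(t_2)$, $D^{t_j}_e=(\bigcup_{t\in T_j}\chi(t))\setminus C_e$, set $S_e=(D^{t_1}_e,C_e,D^{t_2}_e)$ (up to exchanging outer entries). A tree decomposition $(T_X,\chi_X)$ corresponding to laminar $X$ is one where every member of $X$ is some $S_e$ and every $S_e\in X$ (one always exists). For $X$ consisting of $(1-c)$-skewed separations, orient each edge $e=t_1t_2$ from $t_1$ to $t_2$ if the member $(A_e,C_e,B_e)=S_e$ of $X$ (with $w(A_e)<1-c$) has $A_e=D^{t_1}_e$, and from $t_2$ to $t_1$ otherwise; when this orientation is an in-arborescence with root $v$ (every vertex has exactly one directed path to $v$), the central bag is $\beta=\chi_X(v)$. $\beta$ is perpendicular to $X$ if $\beta\cap A=\emptyset$ for every $(A,C,B)\in X$. The weight function $w_X$ on $\beta$: for the edges $e_1,\dots,e_k$ of $T_X$ incident with $v$ with corresponding members $(A_{e_i},C_{e_i},B_{e_i})$ of $X$, fix a center $K_{e_i}$ of $C_{e_i}$ and an anchor vertex in $K_{e_i}$; $w_X(u)=w(u)+\sum_{i:\ u\text{ is the anchor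 of }C_{e_i}}w(A_{e_i})$ for $u\in\beta$. -}

module Defs where

open import Level using (0ℓ)
open import Data.Nat as ℕ using (ℕ; zero; suc)
open import Data.Bool using (Bool; true; false; if_then_else_; _∧_; _∨_; not)
open import Data.Fin using (Fin; zero; suc; _≟_)
open import Data.Fin.Subset using (Subset; _∈_; _∉_; _⊆_; _∩_; _∪_; _─_; ⊤; ∣_∣; Nonempty)
open import Data.Fin.Subset.Properties using (_∈?_)
open import Data.Vec using (Vec; []; _∷_; tabulate)
open import Data.List using (List; []; _∷_; length; _∷ʳ_)
open import Data.List.Membership.Propositional using () renaming (_∈_ to _∈ˡ_)
open import Data.List.Relation.Unary.Linked using (Linked)
open import Data.List.Relation.Unary.Unique.Propositional using (Unique)
open import Data.Product using (Σ; ∃; ∃-syntax; _×_; _,_)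
open import Data.Sum using (_⊎_)
open import Data.Empty using (⊥)
open import Relation.Nullary using (¬_; ⌊_⌋)
open import Relation.Binary.PropositionalEquality using (_≡_; _≢_)
open import Algebra.Structures using (IsCommutativeRing)
open import Relation.Binary.Structures using (IsTotalOrder)

-- Ordered fields (the weights, c and m live in an arbitrary ordered
-- field; the reals are an instance).

record OrderedField : Set₁ where
  infixl 6 _+_
  infixl 7 _*_
  infix 4 _≤_ _<_
  field
    Carrier : Set
    _+_ _*_ : Carrier → Carrier → Carrier
    -_      : Carrier → Carrier
    0# 1#   : Carrier
    _≤_     : Carrier → Carrier → Set
    isCommutativeRing : IsCommutativeRing _≡_ _+_ _*_ -_ 0# 1#
    0≢1     : 0# ≢ 1#
    inverse : ∀ x → x ≢ 0# → ∃[ y ] (x * y ≡ 1#)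
    isTotalOrder : IsTotalOrder _≡_ _≤_
    +-mono  : ∀ x y z → x ≤ y → x + z ≤ y + z
    *-pos   : ∀ x y → 0# ≤ x → 0# ≤ y → 0# ≤ x * y

  _<_ : Carrier → Carrier → Set
  x < y = (x ≤ y) × (x ≢ y)

  _-_ : Carrier → Carrier → Carrier
  x - y = x + (- y)

  fromℕ : ℕ → Carrier
  fromℕ zero    = 0#
  fromℕ (suc k) = 1# + fromℕ k

record Graph (n : ℕ) : Set where
  field
    adj    : Fin n → Fin n → Bool
    sym    : ∀ u v → adj u v ≡ adj v u
    irrefl : ∀ u → adj u u ≡ false

-- walks of length ℓ from u to v w.r.t. an adjacency relation R, all of
-- whose vertices lie in S (i.e. walks in the induced subgraph on S)
data Walk {n : ℕ} (R : Fin n → Fin n → Set) (S : Subset n) : Fin n → Fin n → ℕ → Set where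
  nil  : ∀ {u} → u ∈ S → Walk R S u u 0
  cons : ∀ {u x v ℓ} → u ∈ S → R u x → Walk R S x v ℓ → Walk R S u v (suc ℓ)

module _ {n : ℕ} (G : Graph n) where
  open Graph G

  Adj : Fin n → Fin n → Set
  Adj u v = adj u v ≡ true

  Reach : Subset n → Fin n → Fin n → Set
  Reach S u v = ∃[ ℓ ] Walk Adj S u v ℓ

  ConnectedIn : Subset n → Set
  ConnectedIn S = Nonempty S × (∀ u v → u ∈ S → v ∈ S → Reach S u v)

  Connected : Set
  Connected = ConnectedIn ⊤

  degree : Fin n → ℕ
  degree u = ∣ tabulate (adj u) ∣

  MaxDegree : ℕ → Set
  MaxDegree δ = (∀ u → degree u ℕ.≤ δ) × (∃[ u ] degree u ≡ δ)

  InBall : Subset n → ℕ → Fin n → Fin n → Set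
  InBall S d v u = ∃[ ℓ ] (ℓ ℕ.≤ d × Walk Adj S v u ℓ)

  Bounded : Subset n → ℕ → Subset n → Set
  Bounded S d Y =
    Y ⊆ S ×
    ∃[ vs ] (length vs ℕ.≤ d × (∀ {v} → v ∈ˡ vs → v ∈ S) ×
             (∀ {y} → y ∈ Y → ∃[ v ] (v ∈ˡ vs × InBall S d v y)))

  IsComponent : Subset n → Subset n → Set
  IsComponent R Z =
    Z ⊆ R × ConnectedIn Z × (∀ a b → a ∈ Z → b ∈ R → Adj a b → b ∈ Z)

  Clique : Subset n → Set
  Clique K = ∀ a b → a ∈ K → b ∈ K → a ≢ b → Adj a b

  InClosedNbhd : Subset n → Fin n → Set
  InClosedNbhd K u = u ∈ K ⊎ ∃[ a ] (a ∈ K × Adj a u)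

  IsCenter : Subset n → Subset n → Set
  IsCenter K Y = Nonempty K × Clique K × K ⊆ Y × (∀ {u} → u ∈ Y → InClosedNbhd K u)

  CliqueStar : Subset n → Set
  CliqueStar Y = ∃[ K ] IsCenter K Y

  Disjoint : Subset n → Subset n → Set
  Disjoint P Q = ∀ u → u ∈ P → u ∈ Q → ⊥

record Sep (n : ℕ) : Set where
  constructor sep
  field
    A C B : Subset n

module _ {n : ℕ} (G : Graph n) where

  IsSeparation : Sep n → Set
  IsSeparation (sep A C B) =
    Disjoint G A C × Disjoint G A B × Disjoint G C B ×
    (∀ u → u ∈ A ⊎ u ∈ C ⊎ u ∈ B) ×
    (∀ a b → a ∈ A → b ∈ B → ¬ Adj G a b)

  IsStarSeparation : Sep n → Set
  IsStarSeparation s = IsSeparation s × CliqueStar G (Sep.C s)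

NonCrossing : ∀ {n} → Sep n → Sep n → Set
NonCrossing (sep A₁ C₁ B₁) (sep A₂ C₂ B₂) =
  ((X₁ ⊆ X₂ × Y₂ ⊆ Y₁) ⊎ (X₁ ⊆ Y₂ × X₂ ⊆ Y₁)) ⊎
  ((X₂ ⊆ X₁ × Y₁ ⊆ Y₂) ⊎ (X₂ ⊆ Y₁ × X₁ ⊆ Y₂))
  where
  X₁ = A₁ ∪ C₁
  Y₁ = C₁ ∪ B₁
  X₂ = A₂ ∪ C₂
  Y₂ = C₂ ∪ B₂

Laminar : ∀ {n} → List (Sep n) → Set
Laminar X = ∀ {s t} → s ∈ˡ X → t ∈ˡ X → NonCrossing s t

module _ {k : ℕ} (T : Graph k) where

  -- T is a tree: connected and without cycles (a cycle being
  -- x , mid₁ , … , midᵣ , y , x with r ≥ 1 and x , mid , y distinct)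
  IsTree : Set
  IsTree =
    Connected T ×
    (∀ x y (mid : List (Fin k)) → 1 ℕ.≤ length mid →
       Unique ((x ∷ mid) ∷ʳ y) → Linked (Adj T) ((x ∷ mid) ∷ʳ y) → Adj T y x → ⊥)

  AdjMinus : Fin k → Fin k → Fin k → Fin k → Set
  AdjMinus t₁ t₂ a b = Adj T a b × ¬ ((a ≡ t₁ × b ≡ t₂) ⊎ (a ≡ t₂ × b ≡ t₁))

  InSide : Fin k → Fin k → Fin k → Set
  InSide t₁ t₂ t = ∃[ ℓ ] Walk (AdjMinus t₁ t₂) ⊤ t₁ t ℓ

module _ {n k : ℕ} (G : Graph n) (T : Graph k) (χ : Fin k → Subset n) where

  IsTreeDecomposition : Set
  IsTreeDecomposition =
    IsTree T ×
    (∀ u → ∃[ t ] u ∈ χ t) ×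
    (∀ u v → Adj G u v → ∃[ t ] (u ∈ χ t × v ∈ χ t)) ×
    (∀ u t t′ → u ∈ χ t → u ∈ χ t′ →
       ∃[ ℓ ] Walk (Adj T) (tabulate (λ s → ⌊ u ∈? χ s ⌋)) t t′ ℓ)

  Cₑ : Fin k → Fin k → Subset n
  Cₑ t₁ t₂ = χ t₁ ∩ χ t₂

  IsSideSet : Fin k → Fin k → Subset n → Set
  IsSideSet t₁ t₂ D =
    ∀ u → (u ∈ D → u ∉ Cₑ t₁ t₂ × ∃[ t ] (InSide T t₁ t₂ t × u ∈ χ t)) ×
          (u ∉ Cₑ t₁ t₂ × ∃[ t ] (InSide T t₁ t₂ t × u ∈ χ t) → u ∈ D)

  IsSₑ : Fin k → Fin k → Sep n → Set
  IsSₑ t₁ t₂ (sep A C B) = C ≡ Cₑ t₁ t₂ × IsSideSet t₁ t₂ A × IsSideSet t₂ t₁ B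

  Corresponds : List (Sep n) → Set
  Corresponds X =
    IsTreeDecomposition ×
    (∀ {s} → s ∈ˡ X → ∃[ t₁ ] ∃[ t₂ ] (Adj T t₁ t₂ × IsSₑ t₁ t₂ s)) ×
    (∀ t₁ t₂ → Adj T t₁ t₂ → ∃[ s ] (s ∈ˡ X × (IsSₑ t₁ t₂ s ⊎ IsSₑ t₂ t₁ s)))

module Weighted (F : OrderedField) where
  open OrderedField F

  wsum : ∀ {n} → (Fin n → Carrier) → Subset n → Carrier
  wsum ω []            = 0#
  wsum ω (true  ∷ bs)  = ω zero + wsum (λ i → ω (suc i)) bs
  wsum ω (false ∷ bs)  = wsum (λ i → ω (suc i)) bs

  sumFin : ∀ {k} → (Fin k → Carrier) → Carrier
  sumFin {zero}  f = 0#
  sumFin {suc k} f = f zero + sumFin (λ i → f (suc i))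

  module _ {n : ℕ} (G : Graph n) where

    BalancedSeparator : Subset n → (Fin n → Carrier) → Carrier → ℕ → Subset n → Set
    BalancedSeparator S ω c d Y =
      Bounded G S d Y × (∀ Z → IsComponent G (S ─ Y) Z → wsum ω Z ≤ c)

    NoBalancedSeparator : Subset n → (Fin n → Carrier) → Carrier → ℕ → Set
    NoBalancedSeparator S ω c d = ∀ Y → ¬ BalancedSeparator S ω c d Y

  Skewed : ∀ {n} → (Fin n → Carrier) → Carrier → Sep n → Set
  Skewed w ε (sep A C B) = wsum w A < ε ⊎ wsum w B < ε

  module _ {n k : ℕ} (G : Graph n) (T : Graph k) (χ : Fin k → Subset n)
           (w : Fin n → Carrier) (c : Carrier) where

    -- arc t₁ → t₂ of the orientation: t₁t₂ is an edge and the side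
    -- D^{t₁}_e has weight < 1 - c (i.e. it is the A-side)
    Arc : Fin k → Fin k → Set
    Arc t₁ t₂ = Adj T t₁ t₂ × ∃[ D ] (IsSideSet G T χ t₁ t₂ D × wsum w D < 1# - c)

    data DirPath : Fin k → Fin k → List (Fin k) → Set where
      here : ∀ {v} → DirPath v v (v ∷ [])
      step : ∀ {t x v p} → Arc t x → DirPath x v p → DirPath t v (t ∷ p)

    InArborescence : Fin k → Set
    InArborescence v =
      ∀ t → ∃[ p ] ((DirPath t v p × Unique p) ×
                    (∀ q → DirPath t v q → Unique q → q ≡ p))

    Perpendicular : List (Sep n) → Subset n → Set
    Perpendicular X β =
      ∀ {A C B} → sep A C B ∈ˡ X →
        (wsum w A < 1# - c → Disjoint G A β) × (wsum w B < 1# - c → Disjoint G B β)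

    -- valid choices, for the root v, of the sides A_e = D^{t}_e and of
    -- anchors (lying in a center of C_e) for the edges e = tv at v
    ValidSides : Fin k → (Fin k → Subset n) → Set
    ValidSides v D = ∀ t → Adj T v t → IsSideSet G T χ t v (D t)

    ValidAnchors : Fin k → (Fin k → Fin n) → Set
    ValidAnchors v anc =
      ∀ t → Adj T v t → ∃[ K ] (IsCenter G K (Cₑ G T χ v t) × anc t ∈ K)

    wX : Fin k → (Fin k → Subset n) → (Fin k → Fin n) → Fin n → Carrier
    wX v D anc u =
      w u + sumFin (λ t → if Graph.adj T v t ∧ ⌊ anc t ≟ u ⌋ then wsum w (D t) else 0#)

module Submission where

-- A star separation whose two sides both weigh at most c would make its
-- clique star, which lies within distance 2 of a center vertex, a balanced
-- separator; with w(G) = 1 and c ≥ 1/2 one side therefore weighs less than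
-- 1 - c, and only one does. Orienting every tree edge towards its heavy side
-- gives out-degrees at most one, hence an in-arborescence whose sink is the
-- central bag β. Each light side at β meets β only inside its clique star,
-- and w_X moves the weight of the side to an anchor there, so w_X(β) = 1.
-- Finally, if Y were a balanced separator of G[β] for w_X with radius d - 2,
-- its 2-neighbourhood N²[Y] in G would be one for w with radius d: a
-- component of G ∖ N²[Y] missing β lies inside one light side, and one
-- meeting β is dominated in w_X by a component of G[β] ∖ Y.

open import Defs
open import Data.Nat as ℕ using (ℕ; zero; suc; _∸_)
open import Data.Fin as Fin using (Fin; zero; suc; _≟_; toℕ)
open import Data.Fin.Subset using (Subset; _∈_; _∉_; _⊆_; ⊤; _─_)
open import Data.List as List using (List; []; _∷_; length; _∷ʳ_)
open import Data.List.Membership.Propositional using () renaming (_∈_ to _∈ˡ_)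
open import Data.Product using (Σ; ∃; ∃-syntax; _×_; _,_; proj₁; proj₂)
open import Relation.Nullary using (¬_; yes; no; Dec; ⌊_⌋)
open import Relation.Binary.PropositionalEquality

open import Level using (0ℓ)
open import Function using (_∘_)
open import Data.Empty using (⊥; ⊥-elim)
open import Data.Sum using (_⊎_; inj₁; inj₂)
import Data.Sum as Sum
open import Data.Bool using (Bool; true; false; if_then_else_; _∧_)
import Data.Bool as Bool
open import Data.Bool.Properties using (∧-zeroʳ; ∧-identityʳ)
import Data.Nat.Properties as ℕP
import Data.Fin.Properties as FinP
open import Data.Fin.Subset.Properties using (∈⊤; _∈?_; ⊆-antisym; ∩-comm; x∈p∩q⁺; x∈p∩q⁻; x∈p∧x∉q⇒x∈p─q)
open import Data.Vec using ([]; _∷_; there; lookup; tabulate)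
open import Data.Vec.Properties using ([]=⇒lookup; lookup⇒[]=; lookup-replicate; lookup∘tabulate)
open import Data.List.Properties using (length-++)
open import Data.List.Membership.Propositional.Properties using (∈-lookup)
import Data.List.Membership.DecPropositional as DecMembership
open import Data.List.Relation.Unary.Any using (here; there)
open import Data.List.Relation.Unary.All as All using (All; []; _∷_)
open import Data.List.Relation.Unary.All.Properties using (¬Any⇒All¬)
open import Data.List.Relation.Unary.AllPairs using ([]; _∷_)
open import Data.List.Relation.Unary.Linked as Linked using (Linked; [-]; _∷_)
open import Data.List.Relation.Unary.Unique.Propositional using (Unique)
open import Relation.Nullary.Decidable using (_×-dec_)
open import Algebra.Bundles using (CommutativeRing)
open import Algebra.Structures using (IsCommutativeRing)
open import Relation.Binary.Structures using (IsTotalOrder)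
import Algebra.Properties.Ring as RingProperties
import Algebra.Properties.CommutativeSemigroup as CommutativeSemigroupProperties

module _ {n : ℕ} {R : Fin n → Fin n → Set} {S : Subset n} where
  open DecMembership (_≟_ {n}) using () renaming (_∈?_ to _∈ˡ?_)

  initVertices : ∀ {u v ℓ} → Walk R S u v ℓ → List (Fin n)
  initVertices (nil _)          = []
  initVertices (cons {u} _ _ W) = u ∷ initVertices W

  vertices : ∀ {u v ℓ} → Walk R S u v ℓ → List (Fin n)
  vertices {v = v} W = initVertices W ∷ʳ v

  source∈ : ∀ {u v ℓ} → Walk R S u v ℓ → u ∈ S
  source∈ (nil u∈S)      = u∈S
  source∈ (cons u∈S _ _) = u∈S

  target∈ : ∀ {u v ℓ} → Walk R S u v ℓ → v ∈ S
  target∈ (nil v∈S)    = v∈S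
  target∈ (cons _ _ W) = target∈ W

  append : ∀ {u x v ℓ ℓ′} → Walk R S u x ℓ → Walk R S x v ℓ′ → Walk R S u v (ℓ ℕ.+ ℓ′)
  append (nil _)       W′ = W′
  append (cons p r W) W′ = cons p r (append W W′)

  snoc : ∀ {u x y ℓ} → Walk R S u x ℓ → R x y → y ∈ S → ∃[ ℓ′ ] Walk R S u y ℓ′
  snoc W r y∈S = _ , append W (cons (target∈ W) r (nil y∈S))

  vertices-linked : ∀ {u v ℓ} (W : Walk R S u v ℓ) → Linked R (vertices W)
  vertices-linked (nil _)                    = [-]
  vertices-linked (cons _ r (nil _))         = r ∷ [-]
  vertices-linked (cons _ r W@(cons _ _ _)) = r ∷ vertices-linked W

  length-vertices : ∀ {u v ℓ} (W : Walk R S u v ℓ) → length (vertices W) ≡ suc ℓ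
  length-vertices {v = v} W = begin
    length (initVertices W ∷ʳ v)      ≡⟨ length-++ (initVertices W) ⟩
    length (initVertices W) ℕ.+ 1     ≡⟨ ℕP.+-comm _ 1 ⟩
    suc (length (initVertices W))     ≡⟨ cong suc (length-initVertices W) ⟩
    suc _                             ∎
    where
    open ≡-Reasoning
    length-initVertices : ∀ {u v ℓ} (W : Walk R S u v ℓ) → length (initVertices W) ≡ ℓ
    length-initVertices (nil _)      = refl
    length-initVertices (cons _ _ W) = cong suc (length-initVertices W)

  SimpleWalk : Fin n → Fin n → Set
  SimpleWalk u v = ∃[ ℓ ] Σ (Walk R S u v ℓ) (λ W → Unique (vertices W))

  suffixFrom : ∀ {a u v ℓ} (W : Walk R S u v ℓ) → Unique (vertices W) → a ∈ˡ vertices W →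
               SimpleWalk a v
  suffixFrom (nil p)           U (here refl) = _ , nil p , U
  suffixFrom W@(cons _ _ _)   U (here refl) = _ , W , U
  suffixFrom (cons _ _ W) (_ ∷ U) (there a∈W) = suffixFrom W U a∈W

  toSimple : ∀ {u v ℓ} → Walk R S u v ℓ → SimpleWalk u v
  toSimple (nil p) = _ , nil p , [] ∷ []
  toSimple {u} (cons p r W) with toSimple W
  ... | _ , W′ , U with u ∈ˡ? vertices W′
  ...   | no u∉W′  = _ , cons p r W′ , ¬Any⇒All¬ _ u∉W′ ∷ U
  ...   | yes u∈W′ = suffixFrom W′ U u∈W′

  walk-preserves : (P : Fin n → Set) → (∀ {a b} → a ∈ S → b ∈ S → R a b → P a → P b) →
                   ∀ {u v ℓ} → Walk R S u v ℓ → P u → P v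
  walk-preserves P step (nil _)      Pu = Pu
  walk-preserves P step (cons p r W) Pu = walk-preserves P step W (step p (source∈ W) r Pu)

mapWalk : ∀ {n} {R R′ : Fin n → Fin n → Set} {S S′ : Subset n} →
          (∀ {a b} → R a b → R′ a b) → S ⊆ S′ →
          ∀ {u v ℓ} → Walk R S u v ℓ → Walk R′ S′ u v ℓ
mapWalk f g (nil p)      = nil (g p)
mapWalk f g (cons p r W) = cons (g p) (f r) (mapWalk f g W)

reverseWalk : ∀ {n} {R : Fin n → Fin n → Set} {S : Subset n} →
              (∀ {a b} → R a b → R b a) →
              ∀ {u v ℓ} → Walk R S u v ℓ → ∃[ ℓ′ ] Walk R S v u ℓ′
reverseWalk sym (nil p)      = _ , nil p
reverseWalk sym (cons p r W) = let (_ , W′) = reverseWalk sym W in snoc W′ (sym r) p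

unique⇒length≤ : ∀ {n} {xs : List (Fin n)} → Unique xs → length xs ℕ.≤ n
unique⇒length≤ {n} {xs} U with length xs ℕ.≤? n
... | yes ≤n = ≤n
... | no  ≰n with FinP.pigeonhole (ℕP.≰⇒> ≰n) (List.lookup xs)
...   | i , j , i<j , eq = ⊥-elim (distinct U i j i<j eq)
  where
  distinct : ∀ {xs : List (Fin n)} → Unique xs → ∀ i j → i Fin.< j → List.lookup xs i ≢ List.lookup xs j
  distinct (x∉ ∷ U) zero    (suc j) _             = All.lookup x∉ (∈-lookup j)
  distinct (_  ∷ U) (suc i) (suc j) (ℕ.s≤s i<j) = distinct U i j i<j

∈⇒lookup≡true : ∀ {n} {u : Fin n} {S : Subset n} → u ∈ S → lookup S u ≡ true
∈⇒lookup≡true = []=⇒lookup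

∉⇒lookup≡false : ∀ {n} {u : Fin n} {S : Subset n} → u ∉ S → lookup S u ≡ false
∉⇒lookup≡false {u = u} {S} u∉S with lookup S u in eq
... | true  = ⊥-elim (u∉S (lookup⇒[]= u S eq))
... | false = refl

module _ {n : ℕ} {P : Fin n → Set} (P? : ∀ x → Dec (P x)) where

  Satisfying : Subset n
  Satisfying = tabulate (λ x → ⌊ P? x ⌋)

  Satisfying⁺ : ∀ {x} → P x → x ∈ Satisfying
  Satisfying⁺ {x} Px = lookup⇒[]= x Satisfying (trans (lookup∘tabulate (λ z → ⌊ P? z ⌋) x) (true-if-yes (P? x)))
    where
    true-if-yes : (P?x : Dec (P x)) → ⌊ P?x ⌋ ≡ true
    true-if-yes (yes _)  = refl
    true-if-yes (no ¬Px) = ⊥-elim (¬Px Px)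

  Satisfying⁻ : ∀ {x} → x ∈ Satisfying → P x
  Satisfying⁻ {x} x∈ with P? x | trans (sym (lookup∘tabulate (λ z → ⌊ P? z ⌋) x)) ([]=⇒lookup x∈)
  ... | yes Px | _ = Px
  ... | no _   | ()

module OrderedFieldProperties (F : OrderedField) where
  open OrderedField F
  open IsCommutativeRing isCommutativeRing public
    using (+-assoc; +-comm; +-identityˡ; +-identityʳ; -‿inverseʳ)
  open IsTotalOrder isTotalOrder public
    using (total; antisym) renaming (refl to ≤-refl; trans to ≤-trans)

  commutativeRing : CommutativeRing 0ℓ 0ℓ
  commutativeRing = record { isCommutativeRing = isCommutativeRing }

  open RingProperties (CommutativeRing.ring commutativeRing) using (-‿injective; +-cancelˡ)
  open CommutativeSemigroupProperties (CommutativeRing.+-commutativeSemigroup commutativeRing)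
    using (interchange)

  private variable
    x y z : Carrier

  x+[-x+y]≡y : ∀ x y → x + (- x + y) ≡ y
  x+[-x+y]≡y x y = begin
    x + (- x + y)  ≡⟨ +-assoc x (- x) y ⟨
    x - x + y      ≡⟨ cong (_+ y) (-‿inverseʳ x) ⟩
    0# + y         ≡⟨ +-identityˡ y ⟩
    y              ∎
    where open ≡-Reasoning

  x+y-y≡x : ∀ x y → (x + y) - y ≡ x
  x+y-y≡x x y = begin
    (x + y) - y    ≡⟨ +-assoc x y (- y) ⟩
    x + (y - y)    ≡⟨ cong (x +_) (-‿inverseʳ y) ⟩
    x + 0#         ≡⟨ +-identityʳ x ⟩
    x              ∎
    where open ≡-Reasoning

  ≤-reflexive : x ≡ y → x ≤ y
  ≤-reflexive refl = ≤-refl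

  ≤-<-trans : x ≤ y → y < z → x < z
  ≤-<-trans x≤y (y≤z , y≢z) = ≤-trans x≤y y≤z , λ { refl → y≢z (antisym y≤z x≤y) }

  ≰⇒> : ¬ x ≤ y → y < x
  ≰⇒> {x} {y} x≰y with total x y
  ... | inj₁ x≤y = ⊥-elim (x≰y x≤y)
  ... | inj₂ y≤x = y≤x , λ { refl → x≰y ≤-refl }

  +-monoˡ-≤ : ∀ z → x ≤ y → x + z ≤ y + z
  +-monoˡ-≤ z x≤y = +-mono _ _ z x≤y

  +-monoʳ-≤ : ∀ z → x ≤ y → z + x ≤ z + y
  +-monoʳ-≤ {x} {y} z x≤y = subst₂ _≤_ (+-comm x z) (+-comm y z) (+-monoˡ-≤ z x≤y)

  +-mono-≤ : ∀ {u v} → x ≤ y → u ≤ v → x + u ≤ y + v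
  +-mono-≤ {y = y} {u} x≤y u≤v = ≤-trans (+-monoˡ-≤ u x≤y) (+-monoʳ-≤ y u≤v)

  +-monoʳ-< : ∀ z → x < y → z + x < z + y
  +-monoʳ-< z (x≤y , x≢y) = +-monoʳ-≤ z x≤y , λ eq → x≢y (+-cancelˡ z _ _ eq)

  -‿antitone-≤ : x ≤ y → - y ≤ - x
  -‿antitone-≤ {x} {y} x≤y = subst₂ _≤_ (x+[-x+y]≡y x (- y)) -x-side (+-monoˡ-≤ (- x + - y) x≤y)
    where
    -x-side : y + (- x + - y) ≡ - x
    -x-side = trans (cong (y +_) (+-comm (- x) (- y))) (x+[-x+y]≡y y (- x))

  -‿antitone-< : x < y → - y < - x
  -‿antitone-< (x≤y , x≢y) = -‿antitone-≤ x≤y , λ eq → x≢y (sym (-‿injective eq))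

  x+y≤z⇒x≤z-y : x + y ≤ z → x ≤ z - y
  x+y≤z⇒x≤z-y {x} {y} x+y≤z = subst (_≤ _) (x+y-y≡x x y) (+-monoˡ-≤ (- y) x+y≤z)

  module _ {c : Carrier} (1≤c+c : 1# ≤ c + c) where

    1-c≤c : 1# - c ≤ c
    1-c≤c = subst (1# - c ≤_) (x+y-y≡x c c) (+-monoˡ-≤ (- c) 1≤c+c)

    <1-c⇒≤c : x < 1# - c → x ≤ c
    <1-c⇒≤c (x≤1-c , _) = ≤-trans x≤1-c 1-c≤c

    x+y≤1∧y≰c⇒x<1-c : x + y ≤ 1# → ¬ y ≤ c → x < 1# - c
    x+y≤1∧y≰c⇒x<1-c x+y≤1 y≰c =
      ≤-<-trans (x+y≤z⇒x≤z-y x+y≤1) (+-monoʳ-< 1# (-‿antitone-< (≰⇒> y≰c)))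

    x+y≤1⇒x<1-c⊎y<1-c : x + y ≤ 1# → ¬ (x ≤ c × y ≤ c) → x < 1# - c ⊎ y < 1# - c
    x+y≤1⇒x<1-c⊎y<1-c {x} {y} x+y≤1 not-both with total x c
    ... | inj₁ x≤c = inj₁ (x+y≤1∧y≰c⇒x<1-c x+y≤1 (λ y≤c → not-both (x≤c , y≤c)))
    ... | inj₂ c≤x = inj₂ (x+y≤1∧y≰c⇒x<1-c y+x≤1 (λ x≤c → not-both (x≤c , y≤c)))
      where
      y+x≤1 : y + x ≤ 1#
      y+x≤1 = subst (_≤ 1#) (+-comm x y) x+y≤1
      y≤c : y ≤ c
      y≤c = ≤-trans (x+y≤z⇒x≤z-y y+x≤1) (≤-trans (+-monoʳ-≤ 1# (-‿antitone-≤ c≤x)) 1-c≤c)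

  open Weighted F

  when : Bool → Carrier → Carrier
  when b x = if b then x else 0#

  when-∧ : ∀ a b x → when (a ∧ b) x ≡ when a (when b x)
  when-∧ true  b x = refl
  when-∧ false b x = refl

  when-0 : ∀ b → when b 0# ≡ 0#
  when-0 true  = refl
  when-0 false = refl

  when-+ : ∀ b x y → when b (x + y) ≡ when b x + when b y
  when-+ true  x y = refl
  when-+ false x y = sym (+-identityˡ 0#)

  when-nonneg : ∀ b → 0# ≤ x → 0# ≤ when b x
  when-nonneg true  0≤x = 0≤x
  when-nonneg false _   = ≤-refl

  sumFin-cong : ∀ {k} {f g : Fin k → Carrier} → (∀ i → f i ≡ g i) → sumFin f ≡ sumFin g
  sumFin-cong {zero}  f≡g = refl
  sumFin-cong {suc k} f≡g = cong₂ _+_ (f≡g zero) (sumFin-cong (λ i → f≡g (suc i)))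

  sumFin-0 : ∀ k → sumFin {k} (λ _ → 0#) ≡ 0#
  sumFin-0 zero    = refl
  sumFin-0 (suc k) = trans (cong (0# +_) (sumFin-0 k)) (+-identityˡ 0#)

  sumFin-+ : ∀ {k} (f g : Fin k → Carrier) → sumFin (λ i → f i + g i) ≡ sumFin f + sumFin g
  sumFin-+ {zero}  f g = sym (+-identityˡ 0#)
  sumFin-+ {suc k} f g =
    trans (cong (f zero + g zero +_) (sumFin-+ (λ i → f (suc i)) (λ i → g (suc i))))
          (interchange _ _ _ _)

  sumFin-swap : ∀ {k l} (g : Fin k → Fin l → Carrier) →
                sumFin (λ i → sumFin (λ j → g i j)) ≡ sumFin (λ j → sumFin (λ i → g i j))
  sumFin-swap {zero}  {l} g = sym (sumFin-0 l)
  sumFin-swap {suc k} {l} g =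
    trans (cong (sumFin (g zero) +_) (sumFin-swap (λ i → g (suc i))))
          (sym (sumFin-+ (g zero) (λ j → sumFin (λ i → g (suc i) j))))

  sumFin-single : ∀ {k} (f : Fin k → Carrier) (j : Fin k) → (∀ i → i ≢ j → f i ≡ 0#) →
                  sumFin f ≡ f j
  sumFin-single {suc k} f zero off =
    trans (cong (f zero +_) (trans (sumFin-cong (λ i → off (suc i) (λ ()))) (sumFin-0 k)))
          (+-identityʳ _)
  sumFin-single {suc k} f (suc j) off =
    trans (cong (_+ sumFin (λ i → f (suc i))) (off zero (λ ())))
          (trans (+-identityˡ _)
                 (sumFin-single (λ i → f (suc i)) j (λ i i≢j → off (suc i) (i≢j ∘ FinP.suc-injective))))

  when-sumFin : ∀ {k} b (f : Fin k → Carrier) → when b (sumFin f) ≡ sumFin (λ i → when b (f i))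
  when-sumFin true  f = refl
  when-sumFin {k} false f = sym (sumFin-0 k)

  sumFin-mono : ∀ {k} {f g : Fin k → Carrier} → (∀ i → f i ≤ g i) → sumFin f ≤ sumFin g
  sumFin-mono {zero}  f≤g = ≤-refl
  sumFin-mono {suc k} f≤g = +-mono-≤ (f≤g zero) (sumFin-mono (λ i → f≤g (suc i)))

  sumFin-nonneg : ∀ {k} {f : Fin k → Carrier} → (∀ i → 0# ≤ f i) → 0# ≤ sumFin f
  sumFin-nonneg {k} {f} 0≤f = subst (_≤ sumFin f) (sumFin-0 k) (sumFin-mono 0≤f)

  term≤sumFin : ∀ {k} {f : Fin k → Carrier} → (∀ i → 0# ≤ f i) → ∀ j → f j ≤ sumFin f
  term≤sumFin {suc k} {f} 0≤f zero =
    subst (_≤ sumFin f) (+-identityʳ (f zero)) (+-monoʳ-≤ (f zero) (sumFin-nonneg (λ i → 0≤f (suc i))))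
  term≤sumFin {suc k} {f} 0≤f (suc j) =
    subst (_≤ sumFin f) (+-identityˡ (f (suc j))) (+-mono-≤ (0≤f zero) (term≤sumFin (λ i → 0≤f (suc i)) j))

  wsum≡sumFin-when : ∀ {n} (ω : Fin n → Carrier) (S : Subset n) →
                     wsum ω S ≡ sumFin (λ i → when (lookup S i) (ω i))
  wsum≡sumFin-when ω []          = refl
  wsum≡sumFin-when ω (true  ∷ S) = cong (ω zero +_) (wsum≡sumFin-when (λ i → ω (suc i)) S)
  wsum≡sumFin-when ω (false ∷ S) =
    trans (wsum≡sumFin-when (λ i → ω (suc i)) S) (sym (+-identityˡ _))

  wsum-⊤ : ∀ {n} (ω : Fin n → Carrier) → wsum ω ⊤ ≡ sumFin ω
  wsum-⊤ ω = trans (wsum≡sumFin-when ω ⊤)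
                   (sumFin-cong (λ i → cong (λ b → when b (ω i)) (lookup-replicate i true)))

  module _ {n : ℕ} (ω : Fin n → Carrier) (0≤ω : ∀ u → 0# ≤ ω u) where

    wsum-mono : ∀ {S S′} → S ⊆ S′ → wsum ω S ≤ wsum ω S′
    wsum-mono {S} {S′} S⊆S′ =
      subst₂ _≤_ (sym (wsum≡sumFin-when ω S)) (sym (wsum≡sumFin-when ω S′)) (sumFin-mono pointwise)
      where
      pointwise : ∀ i → when (lookup S i) (ω i) ≤ when (lookup S′ i) (ω i)
      pointwise i with lookup S i in eq
      ... | false = when-nonneg _ (0≤ω i)
      ... | true rewrite ∈⇒lookup≡true (S⊆S′ (lookup⇒[]= i S eq)) = ≤-refl

    wsum-disjoint : ∀ P Q → (∀ u → u ∈ P → u ∈ Q → ⊥) → wsum ω P + wsum ω Q ≤ wsum ω ⊤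
    wsum-disjoint P Q P∩Q=∅ =
      subst₂ _≤_ sum-of-sums (sym (wsum-⊤ ω)) (sumFin-mono (λ i → pointwise i (lookup P i) (lookup Q i) refl refl))
      where
      sum-of-sums : sumFin (λ i → when (lookup P i) (ω i) + when (lookup Q i) (ω i)) ≡ wsum ω P + wsum ω Q
      sum-of-sums = trans (sumFin-+ (λ i → when (lookup P i) (ω i)) (λ i → when (lookup Q i) (ω i)))
                          (sym (cong₂ _+_ (wsum≡sumFin-when ω P) (wsum≡sumFin-when ω Q)))
      pointwise : ∀ i b b′ → lookup P i ≡ b → lookup Q i ≡ b′ → when b (ω i) + when b′ (ω i) ≤ ω i
      pointwise i true  true  eq eq′ = ⊥-elim (P∩Q=∅ i (lookup⇒[]= i P eq) (lookup⇒[]= i Q eq′))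
      pointwise i true  false _  _   = ≤-reflexive (+-identityʳ _)
      pointwise i false true  _  _   = ≤-reflexive (+-identityˡ _)
      pointwise i false false _  _   = subst (_≤ ω i) (sym (+-identityˡ 0#)) (0≤ω i)

x∈p─q⇒x∉q : ∀ {n} {x : Fin n} {p q : Subset n} → x ∈ p ─ q → x ∉ q
x∈p─q⇒x∉q {p = _ ∷ p} {q = _ ∷ q} (there x∈p─q) (there x∈q) = x∈p─q⇒x∉q {p = p} x∈p─q x∈q

module _ {n : ℕ} (G : Graph n) where

  Adj-sym : ∀ {a b} → Adj G a b → Adj G b a
  Adj-sym {a} {b} ab = trans (Graph.sym G b a) ab

  Adj-irrefl : ∀ {a} → ¬ Adj G a a
  Adj-irrefl {a} aa with trans (sym aa) (Graph.irrefl G a)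
  ... | ()

  clique-star-within-2 : ∀ {K Y S} → IsCenter G K Y → K ⊆ S →
                         ∀ {a y} → a ∈ K → y ∈ Y → y ∈ S → InBall G S 2 a y
  clique-star-within-2 (_ , clique , _ , near) K⊆S {a} {y} a∈K y∈Y y∈S with near y∈Y
  ... | inj₁ y∈K with a ≟ y
  ...   | yes refl = 0 , ℕ.z≤n , nil y∈S
  ...   | no  a≢y  = 1 , ℕ.s≤s ℕ.z≤n , cons (K⊆S a∈K) (clique a y a∈K y∈K a≢y) (nil y∈S)
  clique-star-within-2 (_ , clique , _ , near) K⊆S {a} {y} a∈K y∈Y y∈S
    | inj₂ (b , b∈K , by) with a ≟ b
  ...   | yes refl = 1 , ℕ.s≤s ℕ.z≤n , cons (K⊆S a∈K) by (nil y∈S)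
  ...   | no  a≢b  = 2 , ℕP.≤-refl ,
                     cons (K⊆S a∈K) (clique a b a∈K b∈K a≢b) (cons (K⊆S b∈K) by (nil y∈S))

  clique-star-bounded : ∀ {C d} → CliqueStar G C → 2 ℕ.≤ d → Bounded G ⊤ d C
  clique-star-bounded (K , center@((a , a∈K) , _)) 2≤d =
    (λ _ → ∈⊤) , a ∷ [] , ℕP.≤-trans (ℕ.s≤s ℕ.z≤n) 2≤d , (λ { (here refl) → ∈⊤ }) ,
    λ y∈C → let (ℓ , ℓ≤2 , W) = clique-star-within-2 center (λ _ → ∈⊤) a∈K y∈C ∈⊤
            in a , here refl , ℓ , ℕP.≤-trans ℓ≤2 2≤d , W

  separation-sides-closed : ∀ {A C B} → IsSeparation G (sep A C B) → ∀ {x y} → Adj G x y → y ∉ C →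
                            (x ∈ A → y ∈ A) × (x ∈ B → y ∈ B)
  separation-sides-closed {A} {C} {B} (_ , _ , _ , cover , no-edge) {x} {y} xy y∉C with cover y
  ... | inj₁ y∈A        = (λ _ → y∈A) , (λ x∈B → ⊥-elim (no-edge y x y∈A x∈B (Adj-sym xy)))
  ... | inj₂ (inj₁ y∈C) = ⊥-elim (y∉C y∈C)
  ... | inj₂ (inj₂ y∈B) = (λ x∈A → ⊥-elim (no-edge x y x∈A y∈B xy)) , (λ _ → y∈B)

  connected⊆closed : ∀ {Z P : Subset n} → ConnectedIn G Z → ∀ {z} → z ∈ Z → z ∈ P →
                     (∀ {x y} → y ∈ Z → Adj G x y → x ∈ P → y ∈ P) → Z ⊆ P
  connected⊆closed {P = P} (_ , connected) {z} z∈Z z∈P closed {u} u∈Z =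
    walk-preserves (_∈ P) (λ _ y∈Z → closed y∈Z) (proj₂ (connected z u z∈Z u∈Z)) z∈P

  component-on-one-side : ∀ {A C B Z} → IsSeparation G (sep A C B) → IsComponent G (⊤ ─ C) Z →
                          Z ⊆ A ⊎ Z ⊆ B
  component-on-one-side {A} {C} {B} {Z} separation (Z⊆ , connected@((z , z∈Z) , _) , _) =
    by-side-of-z (proj₁ (proj₂ (proj₂ (proj₂ separation))) z)
    where
    closed : ∀ {x y} → y ∈ Z → Adj G x y → (x ∈ A → y ∈ A) × (x ∈ B → y ∈ B)
    closed y∈Z xy = separation-sides-closed separation xy (x∈p─q⇒x∉q {p = ⊤} (Z⊆ y∈Z))
    by-side-of-z : z ∈ A ⊎ z ∈ C ⊎ z ∈ B → Z ⊆ A ⊎ Z ⊆ B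
    by-side-of-z (inj₁ z∈A)        = inj₁ (connected⊆closed connected z∈Z z∈A (λ y∈Z xy → proj₁ (closed y∈Z xy)))
    by-side-of-z (inj₂ (inj₁ z∈C)) = ⊥-elim (x∈p─q⇒x∉q {p = ⊤} (Z⊆ z∈Z) z∈C)
    by-side-of-z (inj₂ (inj₂ z∈B)) = inj₂ (connected⊆closed connected z∈Z z∈B (λ y∈Z xy → proj₂ (closed y∈Z xy)))

module StarSeparations (F : OrderedField) where
  open OrderedField F
  open Weighted F
  open OrderedFieldProperties F

  module _ {n : ℕ} (G : Graph n) (w : Fin n → Carrier) (0≤w : ∀ u → 0# ≤ w u)
           (w⊤≡1 : wsum w ⊤ ≡ 1#) {c : Carrier} (1≤c+c : 1# ≤ c + c) {d : ℕ} (2≤d : 2 ℕ.≤ d)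
           (unbalanced : NoBalancedSeparator G ⊤ w c d) {A C B : Subset n}
           (star : IsStarSeparation G (sep A C B)) where

    -- otherwise the clique star C itself would be a balanced separator
    star-separation-sides-not-both-≤c : ¬ (wsum w A ≤ c × wsum w B ≤ c)
    star-separation-sides-not-both-≤c (wA≤c , wB≤c) =
      unbalanced C (clique-star-bounded G (proj₂ star) 2≤d , components-≤c)
      where
      components-≤c : ∀ Z → IsComponent G (⊤ ─ C) Z → wsum w Z ≤ c
      components-≤c Z component with component-on-one-side G (proj₁ star) component
      ... | inj₁ Z⊆A = ≤-trans (wsum-mono w 0≤w Z⊆A) wA≤c
      ... | inj₂ Z⊆B = ≤-trans (wsum-mono w 0≤w Z⊆B) wB≤c

    star-separation-skewed : Skewed w (1# - c) (sep A C B)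
    star-separation-skewed =
      x+y≤1⇒x<1-c⊎y<1-c 1≤c+c (subst (wsum w A + wsum w B ≤_) w⊤≡1 (wsum-disjoint w 0≤w A B A∩B=∅))
                              star-separation-sides-not-both-≤c
      where
      A∩B=∅ : Disjoint G A B
      A∩B=∅ = proj₁ (proj₂ (proj₁ star))

    star-separation-not-both-light : ¬ (wsum w A < 1# - c × wsum w B < 1# - c)
    star-separation-not-both-light (A-light , B-light) =
      star-separation-sides-not-both-≤c (<1-c⇒≤c 1≤c+c A-light , <1-c⇒≤c 1≤c+c B-light)

module TreeProperties {k : ℕ} (T : Graph k) (tree : IsTree T) where

  AdjMinus-sym : ∀ {t₁ t₂ a b} → AdjMinus T t₁ t₂ a b → AdjMinus T t₁ t₂ b a
  AdjMinus-sym (ab , ab≢e) = Adj-sym T ab , λ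
    { (inj₁ (refl , refl)) → ab≢e (inj₂ (refl , refl))
    ; (inj₂ (refl , refl)) → ab≢e (inj₁ (refl , refl)) }

  AdjMinus-flip : ∀ {t₁ t₂ a b} → AdjMinus T t₁ t₂ a b → AdjMinus T t₂ t₁ a b
  AdjMinus-flip (ab , ab≢e) = ab , λ { (inj₁ e) → ab≢e (inj₂ e) ; (inj₂ e) → ab≢e (inj₁ e) }

  InSide-refl : ∀ {t₁ t₂} → InSide T t₁ t₂ t₁
  InSide-refl = 0 , nil ∈⊤

  InSide-step : ∀ {t₁ t₂ a b} → InSide T t₁ t₂ a → AdjMinus T t₁ t₂ a b → InSide T t₁ t₂ b
  InSide-step (_ , W) ab = snoc W ab ∈⊤

  -- a simple path t₁ … t₂ avoiding the edge closes a cycle with it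
  edge-is-bridge : ∀ {t₁ t₂} → Adj T t₁ t₂ → ¬ InSide T t₁ t₂ t₂
  edge-is-bridge {t₁} {t₂} e (_ , W) with toSimple W
  ... | _ , nil _ , _                          = Adj-irrefl T e
  ... | _ , cons _ r (nil _) , _               = proj₂ r (inj₁ (refl , refl))
  ... | _ , P@(cons _ _ (cons {x} _ _ P′)) , U =
    proj₂ tree t₁ t₂ (x ∷ initVertices P′) (ℕ.s≤s ℕ.z≤n) U (Linked.map proj₁ (vertices-linked P))
          (Adj-sym T e)

  sides-disjoint : ∀ {t₁ t₂ s} → Adj T t₁ t₂ → InSide T t₁ t₂ s → InSide T t₂ t₁ s → ⊥
  sides-disjoint e (_ , W₁) (_ , W₂) =
    let (_ , W₂⁻¹) = reverseWalk AdjMinus-sym W₂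
    in edge-is-bridge e (_ , append W₁ (mapWalk AdjMinus-flip (λ p → p) W₂⁻¹))

  crossing-walk-uses-edge : ∀ {t₁ t₂} → Adj T t₁ t₂ → ∀ {U s s′ ℓ} → Walk (Adj T) U s s′ ℓ →
                            InSide T t₁ t₂ s → InSide T t₂ t₁ s′ → t₁ ∈ U × t₂ ∈ U
  crossing-walk-uses-edge e (nil _) i i′ = ⊥-elim (sides-disjoint e i i′)
  crossing-walk-uses-edge {t₁} {t₂} e (cons {a} {b} a∈U ab W) i i′
    with a ≟ t₁ | b ≟ t₂ | a ≟ t₂ | b ≟ t₁
  ... | yes refl | yes refl | _        | _        = a∈U , source∈ W
  ... | _        | _        | yes refl | yes refl = source∈ W , a∈U
  ... | yes refl | no b≢t₂  | _        | _        =
    crossing-walk-uses-edge e W (InSide-step i (ab , λ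
      { (inj₁ (_ , b≡t₂)) → b≢t₂ b≡t₂ ; (inj₂ (a≡t₂ , _)) → Adj-irrefl T (subst (Adj T a) (sym a≡t₂) e) })) i′
  ... | no a≢t₁  | _        | yes refl | no b≢t₁  =
    crossing-walk-uses-edge e W (InSide-step i (ab , λ
      { (inj₁ (a≡t₁ , _)) → a≢t₁ a≡t₁ ; (inj₂ (_ , b≡t₁)) → b≢t₁ b≡t₁ })) i′
  ... | no a≢t₁  | _        | no a≢t₂  | _        =
    crossing-walk-uses-edge e W (InSide-step i (ab , λ
      { (inj₁ (a≡t₁ , _)) → a≢t₁ a≡t₁ ; (inj₂ (a≡t₂ , _)) → a≢t₂ a≡t₂ })) i′

  InSide-neighbour : ∀ {t x y s} → x ≢ y → Adj T t x → Adj T t y → InSide T x t s → InSide T t y s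
  InSide-neighbour {t} {x} {y} x≢y tx ty (_ , W) = _ , cons ∈⊤ (tx , tx≢ty) (retarget InSide-refl W)
    where
    tx≢ty : ¬ ((t ≡ t × x ≡ y) ⊎ (t ≡ y × x ≡ t))
    tx≢ty (inj₁ (_ , x≡y)) = x≢y x≡y
    tx≢ty (inj₂ (refl , _)) = Adj-irrefl T ty
    not-t : ∀ {z} → InSide T x t z → z ≢ t
    not-t iz refl = edge-is-bridge (Adj-sym T tx) iz
    retarget : ∀ {a b ℓ} → InSide T x t a → Walk (AdjMinus T x t) ⊤ a b ℓ → Walk (AdjMinus T t y) ⊤ a b ℓ
    retarget ia (nil p) = nil p
    retarget ia (cons p ab W′) = cons p (proj₁ ab , ab≢ty) (retarget (InSide-step ia ab) W′)
      where
      ab≢ty : ¬ ((_ ≡ t × _ ≡ y) ⊎ (_ ≡ y × _ ≡ t))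
      ab≢ty (inj₁ (a≡t , _)) = not-t ia a≡t
      ab≢ty (inj₂ (_ , b≡t)) = not-t (InSide-step ia ab) b≡t

module TreeDecompositionProperties {n k : ℕ} (G : Graph n) (T : Graph k) (χ : Fin k → Subset n)
                                   (td : IsTreeDecomposition G T χ) where
  open TreeProperties T (proj₁ td)

  -- running intersection property, across one edge
  bags-meet-across-edge : ∀ {t₁ t₂ u s s′} → Adj T t₁ t₂ →
                          u ∈ χ s → InSide T t₁ t₂ s → u ∈ χ s′ → InSide T t₂ t₁ s′ →
                          u ∈ Cₑ G T χ t₁ t₂
  bags-meet-across-edge {u = u} {s} {s′} e u∈s i u∈s′ i′
    with crossing-walk-uses-edge e (proj₂ (proj₂ (proj₂ (proj₂ td)) u s s′ u∈s u∈s′)) i i′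
  ... | t₁∈ , t₂∈ = x∈p∩q⁺ (Satisfying⁻ (λ s → u ∈? χ s) t₁∈ , Satisfying⁻ (λ s → u ∈? χ s) t₂∈)

  IsSideSet-unique : ∀ {t₁ t₂ D D′} → IsSideSet G T χ t₁ t₂ D → IsSideSet G T χ t₁ t₂ D′ → D ≡ D′
  IsSideSet-unique side side′ =
    ⊆-antisym (λ {u} u∈D → proj₂ (side′ u) (proj₁ (side u) u∈D))
              (λ {u} u∈D′ → proj₂ (side u) (proj₁ (side′ u) u∈D′))

  side-set-avoids-far-bags : ∀ {t₁ t₂ D u s} → Adj T t₁ t₂ → IsSideSet G T χ t₁ t₂ D →
                             u ∈ D → InSide T t₂ t₁ s → u ∉ χ s
  side-set-avoids-far-bags e side u∈D i u∈s with proj₁ (side _) u∈D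
  ... | u∉C , s₀ , i₀ , u∈s₀ = u∉C (bags-meet-across-edge e u∈s₀ i₀ u∈s i)

  side-set-⊆-neighbour-side : ∀ {t x y E D} → x ≢ y → Adj T t x → Adj T t y →
                              IsSideSet G T χ x t E → IsSideSet G T χ t y D → E ⊆ D
  side-set-⊆-neighbour-side {t} {x} {y} x≢y tx ty E-side D-side {u} u∈E with proj₁ (E-side u) u∈E
  ... | _ , s , x-side , u∈s =
    proj₂ (D-side u) (u∉χt ∘ proj₁ ∘ x∈p∩q⁻ (χ t) (χ y) , s , InSide-neighbour x≢y tx ty x-side , u∈s)
    where
    u∉χt : u ∉ χ t
    u∉χt = side-set-avoids-far-bags (Adj-sym T tx) E-side u∈E InSide-refl

-- An orientation of a tree with out-degrees at most one is an
-- in-arborescence: following arcs must stop, as a directed cycle would be a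
-- cycle of the tree, and adjacent vertices flow to the same sink.
module Arborescence (F : OrderedField) {n k : ℕ} (G : Graph n) (T : Graph k)
  (χ : Fin k → Subset n) (w : Fin n → OrderedField.Carrier F) (c : OrderedField.Carrier F)
  (tree : IsTree T)
  (oriented : ∀ {a b} → Adj T a b → Weighted.Arc F G T χ w c a b ⊎ Weighted.Arc F G T χ w c b a)
  (antisymmetric : ∀ {a b} → Weighted.Arc F G T χ w c a b → Weighted.Arc F G T χ w c b a → ⊥)
  (out-functional : ∀ {t x y} → Weighted.Arc F G T χ w c t x → Weighted.Arc F G T χ w c t y → x ≡ y)
  where

  open Weighted F using (DirPath; here; step; InArborescence)
  open TreeProperties T tree using (InSide-refl; InSide-step)

  infix 4 _↝_
  _↝_ : Fin k → Fin k → Set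
  _↝_ = Weighted.Arc F G T χ w c

  _↝?_ : ∀ a b → Dec (a ↝ b)
  a ↝? b with Graph.adj T a b Bool.≟ true
  ... | no ¬ab = no λ a↝b → ¬ab (proj₁ a↝b)
  ... | yes ab with oriented ab
  ...   | inj₁ a↝b = yes a↝b
  ...   | inj₂ b↝a = no λ a↝b → antisymmetric a↝b b↝a

  Sink : Fin k → Set
  Sink t = ∀ x → ¬ t ↝ x

  -- the out-neighbour, or t itself at a sink
  next : Fin k → Fin k
  next t with FinP.any? (t ↝?_)
  ... | yes (x , _) = x
  ... | no _        = t

  next-step : ∀ t → t ↝ next t ⊎ Sink t
  next-step t with FinP.any? (t ↝?_)
  ... | yes (_ , t↝x) = inj₁ t↝x
  ... | no  none      = inj₂ λ x t↝x → none (x , t↝x)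

  next-sink : ∀ {t} → Sink t → next t ≡ t
  next-sink {t} sink with FinP.any? (t ↝?_)
  ... | yes (x , t↝x) = ⊥-elim (sink x t↝x)
  ... | no _          = refl

  next-arc : ∀ {t x} → t ↝ x → next t ≡ x
  next-arc {t} t↝x with FinP.any? (t ↝?_)
  ... | yes (_ , t↝x′) = out-functional t↝x′ t↝x
  ... | no none        = ⊥-elim (none (_ , t↝x))

  next^ : ℕ → Fin k → Fin k
  next^ zero    t = t
  next^ (suc i) t = next (next^ i t)

  next^-+ : ∀ i j t → next^ (i ℕ.+ j) t ≡ next^ i (next^ j t)
  next^-+ zero    j t = refl
  next^-+ (suc i) j t = cong next (next^-+ i j t)

  next^-sink : ∀ i m t → Sink (next^ i t) → next^ (m ℕ.+ i) t ≡ next^ i t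
  next^-sink i zero    t sink = refl
  next^-sink i (suc m) t sink = trans (cong next (next^-sink i m t sink)) (next-sink sink)

  next^-next : ∀ i t → next^ i (next t) ≡ next^ (suc i) t
  next^-next zero    t = refl
  next^-next (suc i) t = cong next (next^-next i t)

  walk-to-next^ : ∀ i t → ∃[ ℓ ] Walk _↝_ ⊤ t (next^ i t) ℓ
  walk-to-next^ zero    t = 0 , nil ∈⊤
  walk-to-next^ (suc i) t with walk-to-next^ i t | next-step (next^ i t)
  ... | _ , W | inj₁ arc  = _ , append W (cons ∈⊤ arc (nil ∈⊤))
  ... | ℓ , W | inj₂ sink = ℓ , subst (λ z → Walk _↝_ ⊤ t z ℓ) (sym (next-sink sink)) W

  next^-sink-or-walk : ∀ i t → Sink (next^ i t) ⊎ Walk _↝_ ⊤ t (next^ i t) i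
  next^-sink-or-walk zero    t = inj₂ (nil ∈⊤)
  next^-sink-or-walk (suc i) t with next^-sink-or-walk i t
  ... | inj₁ sink = inj₁ (subst Sink (sym (next-sink sink)) sink)
  ... | inj₂ W with next-step (next^ i t)
  ...   | inj₂ sink = inj₁ (subst Sink (sym (next-sink sink)) sink)
  ...   | inj₁ arc  = inj₂ (subst (Walk _↝_ ⊤ t _) (ℕP.+-comm i 1) (append W (cons ∈⊤ arc (nil ∈⊤))))

  no-directed-cycle : ∀ {a ℓ} → ¬ Walk _↝_ ⊤ a a (suc ℓ)
  no-directed-cycle {a} (cons _ a↝b W) with toSimple W
  ... | _ , nil _ , _                 = Adj-irrefl T (proj₁ a↝b)
  ... | _ , cons _ b↝a (nil _) , _    = antisymmetric a↝b b↝a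
  ... | _ , P@(cons {b} _ _ (cons {x} _ _ P′)) , U =
    proj₂ tree b a (x ∷ initVertices P′) (ℕ.s≤s ℕ.z≤n) U (Linked.map proj₁ (vertices-linked P))
          (proj₁ a↝b)

  return⇒sink : ∀ {d a} → 0 ℕ.< d → next^ d a ≡ a → Sink a
  return⇒sink {suc d} {a} _ loop with next^-sink-or-walk (suc d) a
  ... | inj₁ sink = subst Sink loop sink
  ... | inj₂ W    = ⊥-elim (no-directed-cycle (subst (λ z → Walk _↝_ ⊤ a z (suc d)) loop W))

  -- two of next^ 0 t , … , next^ k t coincide
  next^k-sink : ∀ t → Sink (next^ k t)
  next^k-sink t with FinP.pigeonhole (ℕP.n<1+n k) (λ (i : Fin (suc k)) → next^ (toℕ i) t)
  ... | i , j , i<j , next^i≡next^j = subst Sink (sym reach-k) sink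
    where
    d : ℕ
    d = toℕ j ∸ toℕ i
    a : Fin k
    a = next^ (toℕ i) t
    loop : next^ d a ≡ a
    loop = begin
      next^ d a                ≡⟨ next^-+ d (toℕ i) t ⟨
      next^ (d ℕ.+ toℕ i) t    ≡⟨ cong (λ z → next^ z t) (ℕP.m∸n+n≡m (ℕP.<⇒≤ i<j)) ⟩
      next^ (toℕ j) t          ≡⟨ next^i≡next^j ⟨
      a                        ∎
      where open ≡-Reasoning
    sink : Sink a
    sink = return⇒sink (ℕP.m<n⇒0<n∸m i<j) loop
    i≤k : toℕ i ℕ.≤ k
    i≤k = ℕP.≤-pred (FinP.toℕ<n i)
    reach-k : next^ k t ≡ a
    reach-k = trans (cong (λ z → next^ z t) (sym (ℕP.m∸n+n≡m i≤k))) (next^-sink (toℕ i) (k ∸ toℕ i) t sink)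

  sink-of : Fin k → Fin k
  sink-of = next^ k

  sink-of-arc : ∀ {t x} → t ↝ x → sink-of x ≡ sink-of t
  sink-of-arc {t} t↝x =
    trans (cong (next^ k) (sym (next-arc t↝x))) (trans (next^-next k t) (next-sink (next^k-sink t)))

  sink-of-constant : ∀ a b → sink-of a ≡ sink-of b
  sink-of-constant a b =
    sym (walk-preserves (λ z → sink-of z ≡ sink-of a) along-edge (proj₂ (proj₂ (proj₁ tree) a b ∈⊤ ∈⊤)) refl)
    where
    along-edge : ∀ {x y} → x ∈ ⊤ → y ∈ ⊤ → Adj T x y → sink-of x ≡ sink-of a → sink-of y ≡ sink-of a
    along-edge _ _ xy eq with oriented xy
    ... | inj₁ x↝y = trans (sink-of-arc x↝y) eq
    ... | inj₂ y↝x = trans (sym (sink-of-arc y↝x)) eq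

  abstract
    root : Fin k
    root = sink-of (proj₁ (proj₁ (proj₁ tree)))

    root-sink : Sink root
    root-sink = next^k-sink _

    sink-of≡root : ∀ t → sink-of t ≡ root
    sink-of≡root t = sink-of-constant t _

  not-incident : ∀ {t₁ t₂ x y : Fin k} → t₁ ≢ x → t₁ ≢ y →
                 ¬ ((x ≡ t₂ × y ≡ t₁) ⊎ (x ≡ t₁ × y ≡ t₂))
  not-incident t₁≢x t₁≢y (inj₁ (_ , y≡t₁)) = t₁≢y (sym y≡t₁)
  not-incident t₁≢x t₁≢y (inj₂ (x≡t₁ , _)) = t₁≢x (sym x≡t₁)

  walk→DirPath : ∀ {t v ℓ} (W : Walk _↝_ ⊤ t v ℓ) → DirPath G T χ w c t v (vertices W)
  walk→DirPath (nil _)        = here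
  walk→DirPath (cons _ arc W) = step arc (walk→DirPath W)

  DirPath-unique : ∀ {t v p q} → Sink v → DirPath G T χ w c t v p → DirPath G T χ w c t v q → q ≡ p
  DirPath-unique sink here         here           = refl
  DirPath-unique sink here         (step arc _)   = ⊥-elim (sink _ arc)
  DirPath-unique sink (step arc _) here           = ⊥-elim (sink _ arc)
  DirPath-unique sink (step {t} arc P) (step arc′ Q) with out-functional arc arc′
  ... | refl = cong (t ∷_) (DirPath-unique sink P Q)

  path-to-root : ∀ t → ∃[ p ] (DirPath G T χ w c t root p × Unique p)
  path-to-root t with walk-to-next^ k t
  ... | _ , W with toSimple (subst (λ z → Walk _↝_ ⊤ t z _) (sink-of≡root t) W)
  ...   | _ , P , U = vertices P , walk→DirPath P , U

  in-arborescence : InArborescence G T χ w c root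
  in-arborescence t with path-to-root t
  ... | p , P , U = p , (P , U) , λ q Q _ → DirPath-unique root-sink P Q

  DirPath-avoiding : ∀ {t₁ t₂ x v p} → DirPath G T χ w c x v p → All (t₁ ≢_) p →
                     ∃[ ℓ ] Walk (AdjMinus T t₂ t₁) ⊤ x v ℓ
  DirPath-avoiding here _ = _ , nil ∈⊤
  DirPath-avoiding (step x↝y here) (t₁≢x ∷ t₁≢y ∷ _) =
    _ , cons ∈⊤ (proj₁ x↝y , not-incident t₁≢x t₁≢y) (nil ∈⊤)
  DirPath-avoiding (step x↝y P@(step _ _)) (t₁≢x ∷ rest@(t₁≢y ∷ _)) =
    _ , cons ∈⊤ (proj₁ x↝y , not-incident t₁≢x t₁≢y) (proj₂ (DirPath-avoiding P rest))

  root-on-head-side : ∀ {t₁ t₂} → t₁ ↝ t₂ → InSide T t₂ t₁ root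
  root-on-head-side {t₁} t₁↝t₂ with path-to-root t₁
  ... | _ , here , _                  = ⊥-elim (root-sink _ t₁↝t₂)
  ... | _ , step t₁↝x P , (t₁∉P ∷ _) with out-functional t₁↝x t₁↝t₂
  ...   | refl = DirPath-avoiding P t₁∉P

  towards-root : ∀ {s v p} → DirPath G T χ w c s v p → Unique p → s ≢ v →
                 ∃[ t ] (Adj T v t × InSide T t v s)
  towards-root here _ s≢v = ⊥-elim (s≢v refl)
  towards-root {s} {v} (step {x = x} s↝x P) (_ ∷ U) s≢v with x ≟ v
  ... | yes refl = s , Adj-sym T (proj₁ s↝x) , InSide-refl
  ... | no  x≢v with towards-root P U x≢v
  ...   | t , vt , x-side =
    t , vt , InSide-step x-side (Adj-sym T (proj₁ s↝x) , λ
      { (inj₁ (_ , s≡v)) → s≢v s≡v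
      ; (inj₂ (x≡v , _)) → x≢v x≡v })

  root-neighbour-towards : ∀ s → s ≢ root → ∃[ t ] (Adj T root t × InSide T t root s)
  root-neighbour-towards s s≢root with path-to-root s
  ... | _ , P , U = towards-root P U s≢root

module _ {n : ℕ} (G : Graph n) (S : Subset n) where

  Adj? : ∀ a b → Dec (Adj G a b)
  Adj? a b = Graph.adj G a b Bool.≟ true

  Walk? : ∀ ℓ a b → Dec (Walk (Adj G) S a b ℓ)
  Walk? zero a b with a ≟ b | a ∈? S
  ... | yes refl | yes a∈S = yes (nil a∈S)
  ... | no  a≢b  | _       = no λ { (nil _) → a≢b refl }
  ... | _        | no a∉S  = no λ { (nil a∈S) → a∉S a∈S }
  Walk? (suc ℓ) a b with a ∈? S | FinP.any? (λ x → Adj? a x ×-dec Walk? ℓ x b)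
  ... | yes a∈S | yes (x , ax , W) = yes (cons a∈S ax W)
  ... | no  a∉S | _                = no λ { (cons a∈S _ _) → a∉S a∈S }
  ... | _       | no  none         = no λ { (cons {x = x} _ ax W) → none (x , ax , W) }

  InBall? : ∀ d a b → Dec (InBall G S d a b)
  InBall? zero a b with Walk? 0 a b
  ... | yes W  = yes (0 , ℕ.z≤n , W)
  ... | no  ¬W = no λ { (zero , _ , W) → ¬W W }
  InBall? (suc d) a b with Walk? (suc d) a b | InBall? d a b
  ... | yes W  | _                = yes (suc d , ℕP.≤-refl , W)
  ... | no  _  | yes (ℓ , ℓ≤d , W) = yes (ℓ , ℕP.m≤n⇒m≤1+n ℓ≤d , W)
  ... | no  ¬W | no  ¬inBall      = no λ { (ℓ , ℓ≤1+d , W) → shorter ℓ ℓ≤1+d W }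
    where
    shorter : ∀ ℓ → ℓ ℕ.≤ suc d → Walk (Adj G) S a b ℓ → ⊥
    shorter ℓ ℓ≤1+d W with ℓ ℕP.≟ suc d
    ... | yes refl = ¬W W
    ... | no  ℓ≢1+d = ¬inBall (ℓ , ℕP.≤-pred (ℕP.≤∧≢⇒< ℓ≤1+d ℓ≢1+d) , W)

  -- a simple walk has at most n vertices, so reachability is a bounded search
  Reach? : ∀ a b → Dec (Reach G S a b)
  Reach? a b with InBall? n a b
  ... | yes (ℓ , _ , W) = yes (ℓ , W)
  ... | no  ¬inBall     = no λ { (_ , W) → ¬inBall (shorten W) }
    where
    shorten : ∀ {ℓ} → Walk (Adj G) S a b ℓ → InBall G S n a b
    shorten W with toSimple W
    ... | ℓ , P , U = ℓ , ℕP.≤-trans (ℕP.n≤1+n ℓ) (subst (ℕ._≤ n) (length-vertices P) (unique⇒length≤ U)) , P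

  reachable : Fin n → Subset n
  reachable z = Satisfying (Reach? z)

  reachable-component : ∀ {z} → z ∈ S → IsComponent G S (reachable z)
  reachable-component {z} z∈S = reachable⊆S , ((z , R⁺ (0 , nil z∈S)) , connected) , closed
    where
    R⁺ : ∀ {x} → Reach G S z x → x ∈ reachable z
    R⁺ = Satisfying⁺ (Reach? z)
    R⁻ : ∀ {x} → x ∈ reachable z → Reach G S z x
    R⁻ = Satisfying⁻ (Reach? z)
    reachable⊆S : reachable z ⊆ S
    reachable⊆S x∈R = target∈ (proj₂ (R⁻ x∈R))
    extend : ∀ {a b} → Reach G S z a → Adj G a b → b ∈ S → Reach G S z b
    extend (_ , W) ab b∈S = snoc W ab b∈S
    closed : ∀ a b → a ∈ reachable z → b ∈ S → Adj G a b → b ∈ reachable z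
    closed a b a∈R b∈S ab = R⁺ (extend (R⁻ a∈R) ab b∈S)
    lift : ∀ {a b ℓ} → Reach G S z a → Walk (Adj G) S a b ℓ → Walk (Adj G) (reachable z) a b ℓ
    lift za (nil _)       = nil (R⁺ za)
    lift za (cons _ ab W) = cons (R⁺ za) ab (lift (extend za ab (source∈ W)) W)
    connected : ∀ a b → a ∈ reachable z → b ∈ reachable z → Reach G (reachable z) a b
    connected a b a∈R b∈R =
      let (_ , a→z) = reverseWalk (Adj-sym G) (proj₂ (R⁻ a∈R))
      in _ , append (lift (R⁻ a∈R) a→z) (lift (0 , nil z∈S) (proj₂ (R⁻ b∈R)))

module _ {n : ℕ} (G : Graph n) where

  neighbourhood : ℕ → Subset n → Subset n
  neighbourhood r Y = Satisfying (λ x → FinP.any? (λ y → y ∈? Y ×-dec InBall? G ⊤ r y x))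

  ⊆neighbourhood : ∀ {r Y} → Y ⊆ neighbourhood r Y
  ⊆neighbourhood {r} {Y} {y} y∈Y = Satisfying⁺ _ (y , y∈Y , 0 , ℕ.z≤n , nil ∈⊤)

  neighbourhood-bounded : ∀ {S Y r d} → r ℕ.≤ d → Bounded G S (d ∸ r) Y → Bounded G ⊤ d (neighbourhood r Y)
  neighbourhood-bounded {S} {Y} {r} {d} r≤d (_ , centres , few , _ , covered) =
    (λ _ → ∈⊤) , centres , ℕP.≤-trans few (ℕP.m∸n≤m d r) , (λ _ → ∈⊤) , covered′
    where
    covered′ : ∀ {x} → x ∈ neighbourhood r Y → ∃[ v ] (v ∈ˡ centres × InBall G ⊤ d v x)
    covered′ x∈N with Satisfying⁻ _ x∈N
    ... | y , y∈Y , ℓ₂ , ℓ₂≤r , W₂ with covered y∈Y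
    ...   | v , v∈centres , ℓ₁ , ℓ₁≤d-r , W₁ =
      v , v∈centres , ℓ₁ ℕ.+ ℓ₂ ,
      subst (ℓ₁ ℕ.+ ℓ₂ ℕ.≤_) (ℕP.m∸n+n≡m r≤d) (ℕP.+-mono-≤ ℓ₁≤d-r ℓ₂≤r) ,
      append (mapWalk (λ e → e) (λ _ → ∈⊤) W₁) W₂

module CentralBag (F : OrderedField) {n : ℕ} (G : Graph n) (w : Fin n → OrderedField.Carrier F)
  (0≤w : ∀ u → OrderedField._≤_ F (OrderedField.0# F) (w u))
  (w⊤≡1 : Weighted.wsum F w ⊤ ≡ OrderedField.1# F)
  {c : OrderedField.Carrier F} (1≤c+c : OrderedField._≤_ F (OrderedField.1# F) (OrderedField._+_ F c c))
  {d : ℕ} (2≤d : 2 ℕ.≤ d) (unbalanced : Weighted.NoBalancedSeparator F G ⊤ w c d)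
  (X : List (Sep n)) (stars : ∀ {s} → s ∈ˡ X → IsStarSeparation G s)
  {k : ℕ} (T : Graph k) (χ : Fin k → Subset n) (corresponds : Corresponds G T χ X) where

  open OrderedField F
  open Weighted F
  open OrderedFieldProperties F
  open StarSeparations F

  td : IsTreeDecomposition G T χ
  td = proj₁ corresponds

  tree : IsTree T
  tree = proj₁ td

  open TreeProperties T tree
  open TreeDecompositionProperties G T χ td

  Light : Subset n → Set
  Light D = wsum w D < 1# - c

  SideSet : Fin k → Fin k → Subset n → Set
  SideSet = IsSideSet G T χ

  record EdgeSides (a b : Fin k) : Set where
    field
      Dᵃ Dᵇ : Subset n
      Dᵃ-side : SideSet a b Dᵃ
      Dᵇ-side : SideSet b a Dᵇ
      one-light : Light Dᵃ ⊎ Light Dᵇ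
      not-both-light : ¬ (Light Dᵃ × Light Dᵇ)

  member-skewed : ∀ {A C B} → sep A C B ∈ˡ X → Light A ⊎ Light B
  member-skewed s∈X = star-separation-skewed G w 0≤w w⊤≡1 1≤c+c 2≤d unbalanced (stars s∈X)

  member-not-both-light : ∀ {A C B} → sep A C B ∈ˡ X → ¬ (Light A × Light B)
  member-not-both-light s∈X = star-separation-not-both-light G w 0≤w w⊤≡1 1≤c+c 2≤d unbalanced (stars s∈X)

  edge-sides : ∀ {a b} → Adj T a b → EdgeSides a b
  edge-sides {a} {b} ab with proj₂ (proj₂ corresponds) a b ab
  ... | sep A C B , s∈X , inj₁ (_ , a-side , b-side) = record
    { Dᵃ-side = a-side ; Dᵇ-side = b-side
    ; one-light = member-skewed s∈X
    ; not-both-light = member-not-both-light s∈X }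
  ... | sep A C B , s∈X , inj₂ (_ , b-side , a-side) = record
    { Dᵃ-side = a-side ; Dᵇ-side = b-side
    ; one-light = Sum.swap (member-skewed s∈X)
    ; not-both-light = λ (B-light , A-light) → member-not-both-light s∈X (A-light , B-light) }

  infix 4 _↝_
  _↝_ : Fin k → Fin k → Set
  _↝_ = Arc G T χ w c

  oriented : ∀ {a b} → Adj T a b → a ↝ b ⊎ b ↝ a
  oriented ab with edge-sides ab
  ... | record { Dᵃ-side = a-side ; one-light = inj₁ light } = inj₁ (ab , _ , a-side , light)
  ... | record { Dᵇ-side = b-side ; one-light = inj₂ light } = inj₂ (Adj-sym T ab , _ , b-side , light)

  antisymmetric : ∀ {a b} → a ↝ b → b ↝ a → ⊥
  antisymmetric (ab , _ , a-side , a-light) (_ , _ , b-side , b-light) =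
    not-both-light (subst Light (IsSideSet-unique a-side Dᵃ-side) a-light ,
                    subst Light (IsSideSet-unique b-side Dᵇ-side) b-light)
    where open EdgeSides (edge-sides ab)

  -- two out-arcs t ↝ x , t ↝ y would make both sides of tx light
  out-functional : ∀ {t x y} → t ↝ x → t ↝ y → x ≡ y
  out-functional {t} {x} {y} (tx , _ , t-side , t-light) (ty , _ , t-side′ , t-light′) with x ≟ y
  ... | yes x≡y = x≡y
  ... | no  x≢y = ⊥-elim (not-both-light (subst Light (IsSideSet-unique t-side Dᵃ-side) t-light , x-light))
    where
    open EdgeSides (edge-sides tx)
    x-light : Light Dᵇ
    x-light = ≤-<-trans (wsum-mono w 0≤w (side-set-⊆-neighbour-side x≢y tx ty Dᵇ-side t-side′)) t-light′

  open Arborescence F G T χ w c tree oriented antisymmetric out-functional public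
    using (root; root-sink; in-arborescence; root-on-head-side; root-neighbour-towards)

  β : Subset n
  β = χ root

  light-side-avoids-β : ∀ {t₁ t₂ D} → Adj T t₁ t₂ → SideSet t₁ t₂ D → Light D → Disjoint G D β
  light-side-avoids-β t₁t₂ side light u u∈D =
    side-set-avoids-far-bags t₁t₂ side u∈D (root-on-head-side (t₁t₂ , _ , side , light))

  perpendicular : Perpendicular G T χ w c X β
  perpendicular s∈X with proj₁ (proj₂ corresponds) s∈X
  ... | _ , _ , t₁t₂ , _ , A-side , B-side =
    light-side-avoids-β t₁t₂ A-side , light-side-avoids-β (Adj-sym T t₁t₂) B-side

  module _ (D : Fin k → Subset n) (anc : Fin k → Fin n)
           (sides : ValidSides G T χ w c root D) (anchors : ValidAnchors G T χ w c root anc) where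

    ωX : Fin n → Carrier
    ωX = wX G T χ w c root D anc

    side-avoids-β : ∀ {t u} → Adj T root t → u ∈ D t → u ∉ β
    side-avoids-β rt u∈D = side-set-avoids-far-bags (Adj-sym T rt) (sides _ rt) u∈D InSide-refl

    outside-β-in-side : ∀ {u} → u ∉ β → ∃[ t ] (Adj T root t × u ∈ D t)
    outside-β-in-side {u} u∉β with proj₁ (proj₂ td) u
    ... | s , u∈s with s ≟ root
    ...   | yes refl = ⊥-elim (u∉β u∈s)
    ...   | no  s≢root with root-neighbour-towards s s≢root
    ...     | t , rt , t-side = t , rt , proj₂ (sides t rt u) (u∉β ∘ proj₂ ∘ x∈p∩q⁻ (χ t) β , s , t-side , u∈s)

    sides-disjoint-at-root : ∀ {t t′ u} → Adj T root t → Adj T root t′ → u ∈ D t → u ∈ D t′ → t ≡ t′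
    sides-disjoint-at-root {t} {t′} {u} rt rt′ u∈D u∈D′ with t ≟ t′
    ... | yes t≡t′ = t≡t′
    ... | no  t≢t′ with proj₁ (sides t rt u) u∈D
    ...   | _ , s , t-side , u∈s =
      ⊥-elim (side-set-avoids-far-bags (Adj-sym T rt′) (sides t′ rt′) u∈D′
                                       (InSide-neighbour t≢t′ rt rt′ t-side) u∈s)

    -- the edge ub lies in a bag, which must be on the t-side
    side-edge : ∀ {t u b} → Adj T root t → u ∈ D t → Adj G u b → b ∈ D t ⊎ b ∈ Cₑ G T χ t root
    side-edge {t} {u} {b} rt u∈D ub with proj₁ (proj₂ (proj₂ td)) u b ub
    ... | s , u∈s , b∈s with b ∈? Cₑ G T χ t root
    ...   | yes b∈C = inj₂ b∈C
    ...   | no  b∉C = inj₁ (proj₂ (sides t rt b) (b∉C , s , s-on-t-side , b∈s))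
      where
      s-on-t-side : InSide T t root s
      s-on-t-side with s ≟ root
      ... | yes refl = ⊥-elim (side-avoids-β rt u∈D u∈s)
      ... | no  s≢root with root-neighbour-towards s s≢root
      ...   | t′ , rt′ , t′-side with t′ ≟ t
      ...     | yes refl = t′-side
      ...     | no  t′≢t = ⊥-elim (side-set-avoids-far-bags (Adj-sym T rt) (sides t rt) u∈D
                                                            (InSide-neighbour t′≢t rt′ rt t′-side) u∈s)

    side-light : ∀ {t} → Adj T root t → Light (D t)
    side-light {t} rt with oriented rt
    ... | inj₁ root↝t = ⊥-elim (root-sink t root↝t)
    ... | inj₂ (_ , _ , side , light) = subst Light (IsSideSet-unique side (sides t rt)) light

    anchor∈β : ∀ {t} → Adj T root t → anc t ∈ β
    anchor∈β {t} rt with anchors t rt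
    ... | _ , (_ , _ , K⊆C , _) , anc∈K = proj₁ (x∈p∩q⁻ β (χ t) (K⊆C anc∈K))

    anchored : Subset n → Fin k → Bool
    anchored S t = lookup S (anc t) ∧ Graph.adj T root t

    -- the share of u in ωX(S): its own weight if u ∈ S, plus its weight once
    -- more for every side containing u whose anchor lies in S
    extra-credit : Subset n → Fin n → Carrier
    extra-credit S u = sumFin (λ t → when (anchored S t) (when (lookup (D t) u) (w u)))

    credit : Subset n → Fin n → Carrier
    credit S u = when (lookup S u) (w u) + extra-credit S u

    anchor-term : ∀ S t →
      sumFin (λ u → when (lookup S u) (when (Graph.adj T root t ∧ ⌊ anc t ≟ u ⌋) (wsum w (D t))))
      ≡ when (anchored S t) (wsum w (D t))
    anchor-term S t = trans (sumFin-single _ (anc t) off-anchor) at-anchor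
      where
      off-anchor : ∀ u → u ≢ anc t →
                   when (lookup S u) (when (Graph.adj T root t ∧ ⌊ anc t ≟ u ⌋) (wsum w (D t))) ≡ 0#
      off-anchor u u≢anc with anc t ≟ u
      ... | yes anc≡u = ⊥-elim (u≢anc (sym anc≡u))
      ... | no  _     = trans (cong (λ b → when (lookup S u) (when b (wsum w (D t)))) (∧-zeroʳ (Graph.adj T root t)))
                              (when-0 (lookup S u))
      at-anchor : when (lookup S (anc t)) (when (Graph.adj T root t ∧ ⌊ anc t ≟ anc t ⌋) (wsum w (D t)))
                  ≡ when (anchored S t) (wsum w (D t))
      at-anchor with anc t ≟ anc t
      ... | yes _ = trans (cong (λ b → when (lookup S (anc t)) (when b (wsum w (D t))))
                                (∧-identityʳ (Graph.adj T root t)))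
                          (sym (when-∧ (lookup S (anc t)) (Graph.adj T root t) (wsum w (D t))))
      ... | no  anc≢anc = ⊥-elim (anc≢anc refl)

    wsum-ωX : ∀ S → wsum ωX S ≡ sumFin (credit S)
    wsum-ωX S = begin
      wsum ωX S
        ≡⟨ wsum≡sumFin-when ωX S ⟩
      sumFin (λ u → when (lookup S u) (w u + sumFin (λ t → g t u)))
        ≡⟨ sumFin-cong split-own ⟩
      sumFin (λ u → own u + sumFin (λ t → when (lookup S u) (g t u)))
        ≡⟨ sumFin-+ own (λ u → sumFin (λ t → when (lookup S u) (g t u))) ⟩
      sumFin own + sumFin (λ u → sumFin (λ t → when (lookup S u) (g t u)))
        ≡⟨ cong (sumFin own +_) (sumFin-swap (λ u t → when (lookup S u) (g t u))) ⟩
      sumFin own + sumFin (λ t → sumFin (λ u → when (lookup S u) (g t u)))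
        ≡⟨ cong (sumFin own +_) (sumFin-cong (anchor-term S)) ⟩
      sumFin own + sumFin (λ t → when (anchored S t) (wsum w (D t)))
        ≡⟨ cong (sumFin own +_) (sumFin-cong side-as-sum) ⟩
      sumFin own + sumFin (λ t → sumFin (λ u → h t u))
        ≡⟨ cong (sumFin own +_) (sumFin-swap h) ⟩
      sumFin own + sumFin (λ u → sumFin (λ t → h t u))
        ≡⟨ sumFin-+ own (λ u → sumFin (λ t → h t u)) ⟨
      sumFin (credit S) ∎
      where
      open ≡-Reasoning
      g : Fin k → Fin n → Carrier
      g t u = when (Graph.adj T root t ∧ ⌊ anc t ≟ u ⌋) (wsum w (D t))
      own : Fin n → Carrier
      own u = when (lookup S u) (w u)
      h : Fin k → Fin n → Carrier
      h t u = when (anchored S t) (when (lookup (D t) u) (w u))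
      split-own : ∀ u → when (lookup S u) (w u + sumFin (λ t → g t u))
                        ≡ own u + sumFin (λ t → when (lookup S u) (g t u))
      split-own u = trans (when-+ (lookup S u) (w u) (sumFin (λ t → g t u)))
                          (cong (own u +_) (when-sumFin (lookup S u) (λ t → g t u)))
      side-as-sum : ∀ t → when (anchored S t) (wsum w (D t)) ≡ sumFin (h t)
      side-as-sum t = trans (cong (when (anchored S t)) (wsum≡sumFin-when w (D t)))
                            (when-sumFin (anchored S t) (λ u → when (lookup (D t) u) (w u)))

    anchored-β : ∀ t → anchored β t ≡ Graph.adj T root t
    anchored-β t = by-adjacency (Graph.adj T root t) refl
      where
      by-adjacency : ∀ b → Graph.adj T root t ≡ b → lookup β (anc t) ∧ b ≡ b
      by-adjacency true  rt = cong (_∧ true) (∈⇒lookup≡true (anchor∈β rt))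
      by-adjacency false _  = ∧-zeroʳ (lookup β (anc t))

    side-term : Fin k → Fin n → Carrier
    side-term t u = when (Graph.adj T root t) (when (lookup (D t) u) (w u))

    side-term-0 : ∀ {t u} → (Adj T root t → u ∉ D t) → side-term t u ≡ 0#
    side-term-0 {t} {u} u∉D with Graph.adj T root t
    ... | false = refl
    ... | true rewrite ∉⇒lookup≡false (u∉D refl) = refl

    side-term-self : ∀ {t u} → Adj T root t → u ∈ D t → side-term t u ≡ w u
    side-term-self {t} {u} rt u∈D =
      trans (cong (λ b → when b (when (lookup (D t) u) (w u))) rt)
            (cong (λ b → when b (w u)) (∈⇒lookup≡true u∈D))

    -- β and the sides at the root partition the vertices
    credit-β : ∀ u → credit β u ≡ w u
    credit-β u =
      trans (cong (when (lookup β u) (w u) +_)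
                  (sumFin-cong (λ t → cong (λ b → when b (when (lookup (D t) u) (w u))) (anchored-β t))))
            (by-membership (u ∈? β))
      where
      by-membership : Dec (u ∈ β) → when (lookup β u) (w u) + sumFin (λ t → side-term t u) ≡ w u
      by-membership (yes u∈β) rewrite ∈⇒lookup≡true u∈β =
        trans (cong (w u +_) (trans (sumFin-cong {f = λ t → side-term t u}
                                                 (λ t → side-term-0 (λ rt u∈D → side-avoids-β rt u∈D u∈β)))
                                    (sumFin-0 k)))
              (+-identityʳ (w u))
      by-membership (no u∉β) rewrite ∉⇒lookup≡false u∉β with outside-β-in-side u∉β
      ... | t₀ , rt₀ , u∈D₀ =
        trans (+-identityˡ _)
              (trans (sumFin-single (λ t → side-term t u) t₀
                       (λ t t≢t₀ → side-term-0 (λ rt u∈D → t≢t₀ (sides-disjoint-at-root rt rt₀ u∈D u∈D₀))))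
                     (side-term-self rt₀ u∈D₀))

    ωX-total : wsum ωX β ≡ 1#
    ωX-total = begin
      wsum ωX β          ≡⟨ wsum-ωX β ⟩
      sumFin (credit β)  ≡⟨ sumFin-cong credit-β ⟩
      sumFin w           ≡⟨ wsum-⊤ w ⟨
      wsum w ⊤           ≡⟨ w⊤≡1 ⟩
      1#                 ∎
      where open ≡-Reasoning

    connected-off-β⊆side : ∀ {Z} → ConnectedIn G Z → (∀ {x} → x ∈ Z → x ∉ β) → ∃[ t ] (Adj T root t × Z ⊆ D t)
    connected-off-β⊆side {Z} Z-connected@((z , z∈Z) , _) Z∩β=∅ with outside-β-in-side (Z∩β=∅ z∈Z)
    ... | t , rt , z∈D = t , rt , connected⊆closed G Z-connected z∈Z z∈D closed
      where
      closed : ∀ {x y} → y ∈ Z → Adj G x y → x ∈ D t → y ∈ D t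
      closed y∈Z xy x∈D with side-edge rt x∈D xy
      ... | inj₁ y∈D = y∈D
      ... | inj₂ y∈C = ⊥-elim (Z∩β=∅ y∈Z (proj₂ (x∈p∩q⁻ (χ t) β y∈C)))

    extra-credit-nonneg : ∀ S u → 0# ≤ extra-credit S u
    extra-credit-nonneg S u = sumFin-nonneg (λ t → when-nonneg (anchored S t) (when-nonneg (lookup (D t) u) (0≤w u)))

    -- A component Z of G ∖ N²[Y] meeting β is covered, within ωX, by the
    -- component Z₀ of G[β ∖ Y] through a common vertex z₀: Z ∩ β lies in Z₀,
    -- and every side that Z enters has its anchor in Z₀.
    module ComponentMeetingβ (Y : Subset n) (small : ∀ Z → IsComponent G (β ─ Y) Z → wsum ωX Z ≤ c)
      {Z : Subset n} (Z∩N²Y=∅ : ∀ {x} → x ∈ Z → x ∉ neighbourhood G 2 Y) (Z-connected : ConnectedIn G Z)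
      {z₀ : Fin n} (z₀∈Z : z₀ ∈ Z) (z₀∈β : z₀ ∈ β) where

      Z∩Y=∅ : ∀ {x} → x ∈ Z → x ∉ Y
      Z∩Y=∅ x∈Z = Z∩N²Y=∅ x∈Z ∘ ⊆neighbourhood G

      Z₀ : Subset n
      Z₀ = reachable G (β ─ Y) z₀

      Z₀-component : IsComponent G (β ─ Y) Z₀
      Z₀-component = reachable-component G (β ─ Y) (x∈p∧x∉q⇒x∈p─q z₀∈β (Z∩Y=∅ z₀∈Z))

      Z₀-walk-closed : ∀ {a b ℓ} → a ∈ Z₀ → Walk (Adj G) (β ─ Y) a b ℓ → b ∈ Z₀
      Z₀-walk-closed a∈Z₀ W =
        walk-preserves (_∈ Z₀) (λ _ b∈S ab a∈Z₀ → proj₂ (proj₂ Z₀-component) _ _ a∈Z₀ b∈S ab) W a∈Z₀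

      SeparatorInZ₀ : Fin k → Set
      SeparatorInZ₀ t = anc t ∈ Z₀ × (∀ {b} → b ∈ Cₑ G T χ root t → b ∉ Y → b ∈ Z₀)

      -- the center of C(root,t) avoids Y, as it is within distance 2 of y ∈ Z
      separator-in-Z₀ : ∀ {t y} → Adj T root t → y ∈ Cₑ G T χ root t → y ∈ Z → y ∈ Z₀ → SeparatorInZ₀ t
      separator-in-Z₀ {t} {y} rt y∈C y∈Z y∈Z₀ with anchors t rt
      ... | K , center@(_ , _ , K⊆C , _) , anc∈K =
        anc∈Z₀ , λ b∈C b∉Y → Z₀-walk-closed anc∈Z₀ (proj₂ (proj₂ (from-anchor b∈C b∉Y)))
        where
        in-β : ∀ {b} → b ∈ Cₑ G T χ root t → b ∈ β
        in-β = proj₁ ∘ x∈p∩q⁻ β (χ t)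
        K∩Y=∅ : ∀ {a} → a ∈ K → a ∉ Y
        K∩Y=∅ a∈K a∈Y =
          Z∩N²Y=∅ y∈Z (Satisfying⁺ _ (_ , a∈Y , clique-star-within-2 G center (λ _ → ∈⊤) a∈K y∈C ∈⊤))
        K⊆β─Y : K ⊆ β ─ Y
        K⊆β─Y a∈K = x∈p∧x∉q⇒x∈p─q (in-β (K⊆C a∈K)) (K∩Y=∅ a∈K)
        from-anchor : ∀ {b} → b ∈ Cₑ G T χ root t → b ∉ Y → InBall G (β ─ Y) 2 (anc t) b
        from-anchor b∈C b∉Y = clique-star-within-2 G center K⊆β─Y anc∈K b∈C (x∈p∧x∉q⇒x∈p─q (in-β b∈C) b∉Y)
        anc∈Z₀ : anc t ∈ Z₀
        anc∈Z₀ = Z₀-walk-closed y∈Z₀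
                   (proj₂ (reverseWalk (Adj-sym G) (proj₂ (proj₂ (from-anchor y∈C (Z∩Y=∅ y∈Z))))))

      Accounted : Fin n → Set
      Accounted x = (x ∈ β → x ∈ Z₀) × (∀ {t} → Adj T root t → x ∈ D t → SeparatorInZ₀ t)

      accounted-step : ∀ {x b} → x ∈ Z → b ∈ Z → Adj G x b → Accounted x → Accounted b
      accounted-step {x} {b} x∈Z b∈Z xb (x-β , x-sides) with x ∈? β
      ... | yes x∈β = b-β , b-sides
        where
        b-β : b ∈ β → b ∈ Z₀
        b-β b∈β = proj₂ (proj₂ Z₀-component) x b (x-β x∈β) (x∈p∧x∉q⇒x∈p─q b∈β (Z∩Y=∅ b∈Z)) xb
        b-sides : ∀ {t} → Adj T root t → b ∈ D t → SeparatorInZ₀ t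
        b-sides {t} rt b∈D with side-edge rt b∈D (Adj-sym G xb)
        ... | inj₁ x∈D = ⊥-elim (side-avoids-β rt x∈D x∈β)
        ... | inj₂ x∈C = separator-in-Z₀ rt (subst (x ∈_) (∩-comm (χ t) β) x∈C) x∈Z (x-β x∈β)
      ... | no x∉β with outside-β-in-side x∉β
      ...   | t₀ , rt₀ , x∈D₀ = b-β , b-sides
        where
        b-β : b ∈ β → b ∈ Z₀
        b-β b∈β with side-edge rt₀ x∈D₀ xb
        ... | inj₁ b∈D₀ = ⊥-elim (side-avoids-β rt₀ b∈D₀ b∈β)
        ... | inj₂ b∈C  = proj₂ (x-sides rt₀ x∈D₀) (subst (b ∈_) (∩-comm (χ t₀) β) b∈C) (Z∩Y=∅ b∈Z)
        b-sides : ∀ {t} → Adj T root t → b ∈ D t → SeparatorInZ₀ t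
        b-sides rt b∈D with side-edge rt₀ x∈D₀ xb
        ... | inj₁ b∈D₀ rewrite sides-disjoint-at-root rt rt₀ b∈D b∈D₀ = x-sides rt₀ x∈D₀
        ... | inj₂ b∈C  = ⊥-elim (side-avoids-β rt b∈D (proj₂ (x∈p∩q⁻ (χ t₀) β b∈C)))

      accounted : ∀ {x} → x ∈ Z → Accounted x
      accounted {x} x∈Z =
        walk-preserves Accounted (λ a∈Z b∈Z → accounted-step a∈Z b∈Z)
                       (proj₂ (proj₂ Z-connected z₀ x z₀∈Z x∈Z)) z₀-accounted
        where
        z₀-accounted : Accounted z₀
        z₀-accounted = (λ _ → Satisfying⁺ _ (0 , nil (x∈p∧x∉q⇒x∈p─q z₀∈β (Z∩Y=∅ z₀∈Z))))
                     , (λ rt z₀∈D → ⊥-elim (side-avoids-β rt z₀∈D z₀∈β))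

      credit-Z₀ : ∀ u → when (lookup Z u) (w u) ≤ credit Z₀ u
      credit-Z₀ u with u ∈? Z
      ... | no u∉Z rewrite ∉⇒lookup≡false u∉Z =
        subst (_≤ credit Z₀ u) (+-identityˡ 0#)
              (+-mono-≤ (when-nonneg (lookup Z₀ u) (0≤w u)) (extra-credit-nonneg Z₀ u))
      ... | yes u∈Z rewrite ∈⇒lookup≡true u∈Z with u ∈? β
      ...   | yes u∈β =
        subst (λ b → w u ≤ when b (w u) + extra-credit Z₀ u) (sym (∈⇒lookup≡true (proj₁ (accounted u∈Z) u∈β)))
              (subst (_≤ w u + extra-credit Z₀ u) (+-identityʳ (w u)) (+-monoʳ-≤ (w u) (extra-credit-nonneg Z₀ u)))
      ...   | no  u∉β with outside-β-in-side u∉β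
      ...     | t₀ , rt₀ , u∈D₀ =
        subst (_≤ credit Z₀ u) (+-identityˡ (w u))
              (+-mono-≤ (when-nonneg (lookup Z₀ u) (0≤w u))
                        (subst (_≤ extra-credit Z₀ u) side-t₀-term
                               (term≤sumFin (λ t → when-nonneg (anchored Z₀ t) (when-nonneg _ (0≤w u))) t₀)))
        where
        side-t₀-term : when (anchored Z₀ t₀) (when (lookup (D t₀) u) (w u)) ≡ w u
        side-t₀-term =
          trans (cong₂ (λ a b → when (a ∧ b) (when (lookup (D t₀) u) (w u)))
                       (∈⇒lookup≡true (proj₁ (proj₂ (accounted u∈Z) rt₀ u∈D₀))) rt₀)
                (cong (λ b → when b (w u)) (∈⇒lookup≡true u∈D₀))

      Z-weight≤c : wsum w Z ≤ c
      Z-weight≤c =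
        ≤-trans (subst₂ _≤_ (sym (wsum≡sumFin-when w Z)) (sym (wsum-ωX Z₀)) (sumFin-mono credit-Z₀))
                (small Z₀ Z₀-component)

    no-balanced-separator : NoBalancedSeparator G β ωX c (d ∸ 2)
    no-balanced-separator Y (bounded , small) =
      unbalanced (neighbourhood G 2 Y) (neighbourhood-bounded G 2≤d bounded , component-light)
      where
      component-light : ∀ Z → IsComponent G (⊤ ─ neighbourhood G 2 Y) Z → wsum w Z ≤ c
      component-light Z (Z⊆ , Z-connected , _) with FinP.any? (λ x → x ∈? Z ×-dec x ∈? β)
      ... | yes (_ , z₀∈Z , z₀∈β) =
        ComponentMeetingβ.Z-weight≤c Y small (x∈p─q⇒x∉q {p = ⊤} ∘ Z⊆) Z-connected z₀∈Z z₀∈β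
      ... | no  Z∩β=∅ with connected-off-β⊆side Z-connected (λ x∈Z x∈β → Z∩β=∅ (_ , x∈Z , x∈β))
      ...   | t , rt , Z⊆D = ≤-trans (wsum-mono w 0≤w Z⊆D) (<1-c⇒≤c 1≤c+c (side-light rt))

  central-bag :
    ∃[ v ] (InArborescence G T χ w c v × Perpendicular G T χ w c X (χ v) ×
            ((D : Fin k → Subset n) (anc : Fin k → Fin n) →
              ValidSides G T χ w c v D → ValidAnchors G T χ w c v anc →
              wsum (wX G T χ w c v D anc) (χ v) ≡ 1# ×
              NoBalancedSeparator G (χ v) (wX G T χ w c v D anc) c (d ∸ 2)))
  central-bag = root , in-arborescence , perpendicular ,
    λ D anc sides anchors → ωX-total D anc sides anchors , no-balanced-separator D anc sides anchors

-- Only c ≥ 1/2, w ≥ 0, w(G) = 1, d ≥ 2 and the absence of a balanced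
-- separator are needed.
lemma2p6 : (F : OrderedField) → let open OrderedField F in let open Weighted F in
    (δ d : ℕ) → 1 ℕ.≤ δ → 2 ℕ.< d →
    (c m : Carrier) → 1# ≤ c + c → c < 1# → 0# ≤ m → m ≤ 1# →
    ((1# - c) + m * fromℕ (δ ℕ.+ δ ℕ.* δ)) + ((1# - c) + m * fromℕ (δ ℕ.+ δ ℕ.* δ)) < 1# →
    {n : ℕ} (G : Graph n) → Connected G → MaxDegree G δ →
    (w : Fin n → Carrier) → (∀ u → 0# ≤ w u × w u ≤ 1#) → wsum w ⊤ ≡ 1# →
    (∀ u → w u ≤ m) →
    NoBalancedSeparator G ⊤ w c d →
    (X : List (Sep n)) → (∀ {s} → s ∈ˡ X → IsStarSeparation G s) → Laminar X →
    (∀ {s} → s ∈ˡ X → Skewed w (1# - c) s) ×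
    ((k : ℕ) (T : Graph k) (χ : Fin k → Subset n) → Corresponds G T χ X →
      ∃[ v ] (InArborescence G T χ w c v ×
              Perpendicular G T χ w c X (χ v) ×
              ((D : Fin k → Subset n) (anc : Fin k → Fin n) →
                ValidSides G T χ w c v D → ValidAnchors G T χ w c v anc →
                wsum (wX G T χ w c v D anc) (χ v) ≡ 1# ×
                NoBalancedSeparator G (χ v) (wX G T χ w c v D anc) c (d ℕ.∸ 2))))
lemma2p6 F _ d _ 2<d _ _ 1≤c+c _ _ _ _ G _ _ w w∈[0,1] w⊤≡1 _ unbalanced X stars _ =
  (λ s∈X → StarSeparations.star-separation-skewed F G w 0≤w w⊤≡1 1≤c+c 2≤d unbalanced (stars s∈X)) ,
  λ k T χ → CentralBag.central-bag F G w 0≤w w⊤≡1 1≤c+c 2≤d unbalanced X stars T χ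
  where
  open OrderedField F
  0≤w : ∀ u → 0# ≤ w u
  0≤w u = proj₁ (w∈[0,1] u)
  2≤d : 2 ℕ.≤ d
  2≤d = ℕP.<⇒≤ 2<d
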